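{- Let $a$ and $b$ be positive integers. (i) The sequence $(1,a,b)$ is a pure $O$-sequence if and only if $\lceil a/2\rceil \leq b\leq \binom{a+1}{2}$. (ii) The sequence $(1,a,a,b)$ is a pure $O$-sequence if and only if $\lceil a/3\rceil \leq b\leq a$.
   Context: Monomials are in finitely many indeterminates $x_1,\ldots,x_s$ (any $s$), each of degree $1$. An order ideal of monomials is a nonempty finite set $\mathcal{A}$ of monomials such that whenever $u\in\mathcal{A}$ and $v$ is a monomial dividing $u$, then $v\in\mathcal{A}$. It is pure if all its maximal elements with respect to divisibility have the same degree. Its $h$-vector is $h(\mathcal{A})=(h_0,\ldots,h_n)$ where $n=\max\{\deg u: u\in\mathcal{A}\}$ and $h_i$ is the number of elements of $\mathcal{A}$ of degree $i$. A finite sequence of positive integers is a pure $O$-sequence if it equals $h(\mathcal{A})$ for some pure order ideal of monomials $\mathcal{A}$. -}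

module Defs where

open import Data.Nat using (ℕ; zero; suc; _+_; _≤_; _<_; _⊔_; _≟_)
open import Data.Nat.DivMod using (_/_)
open import Data.Vec using (Vec; toList)
open import Data.Vec.Relation.Binary.Pointwise.Inductive using (Pointwise)
open import Data.List using (List; []; _∷_; map; foldr; upTo; filter; length)
open import Data.Nat.ListAction using (sum)
open import Data.List.Membership.Propositional using (_∈_)
open import Data.List.Relation.Unary.Unique.Propositional using (Unique)
open import Data.List.Relation.Unary.All using (All)
open import Data.Product using (Σ; _×_; ∃-syntax)
open import Relation.Binary.PropositionalEquality using (_≡_; _≢_)
open import Relation.Nullary using (¬_)

-- A monomial in s indeterminates x₁,…,xₛ is its exponent vector.
Monomial : ℕ → Set
Monomial s = Vec ℕ s

deg : ∀ {s} → Monomial s → ℕ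
deg u = sum (toList u)

_∣ᵐ_ : ∀ {s} → Monomial s → Monomial s → Set
v ∣ᵐ u = Pointwise _≤_ v u

-- A finite set of monomials: a duplicate-free list.
-- Order ideal: nonempty, finite, closed under divisors.
record IsOrderIdeal {s : ℕ} (A : List (Monomial s)) : Set where
  field
    unique    : Unique A
    nonempty  : A ≢ []
    downClosed : ∀ {u v} → u ∈ A → v ∣ᵐ u → v ∈ A

IsMaximal : ∀ {s} → List (Monomial s) → Monomial s → Set
IsMaximal A u = u ∈ A × (∀ {w} → w ∈ A → u ∣ᵐ w → w ≡ u)

IsPure : ∀ {s} → List (Monomial s) → Set
IsPure A = ∀ {u v} → IsMaximal A u → IsMaximal A v → deg u ≡ deg v

maxDeg : ∀ {s} → List (Monomial s) → ℕ
maxDeg A = foldr _⊔_ 0 (map deg A)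

countDeg : ∀ {s} → List (Monomial s) → ℕ → ℕ
countDeg A i = length (filter (λ u → deg u ≟ i) A)

hVector : ∀ {s} → List (Monomial s) → List ℕ
hVector A = map (countDeg A) (upTo (suc (maxDeg A)))

IsPureOSequence : List ℕ → Set
IsPureOSequence h =
  All (λ x → 0 < x) h ×
  ∃[ s ] ∃[ A ] (IsOrderIdeal {s} A × IsPure A × hVector A ≡ h)

⌈_/3⌉ : ℕ → ℕ
⌈ a /3⌉ = (a + 2) / 3

module Submission where

-- h₁ ≤ n hₙ since every variable divides one of the hₙ generators, each a product of n
-- variables, and h₂ ≤ (h₁ + 1) choose 2 since a quadratic monomial is a product of two
-- variables.  For (1, a, a, b) moreover b ≤ a, by a token-counting argument on the graph of
-- variables and quadratic monomials.  Conversely, (1, a, b) is realised by b quadratic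
-- monomials including a pairing of the a variables, and (1, a, a, b) by a disjoint union of
-- b principal ideals of x³, x²y and xyz, h-vectors adding under disjoint unions.

open import Defs
open import Data.Bool using (Bool; true; false)
import Data.Bool as Bool
open import Data.List using (List; []; _∷_; map; foldr; upTo; filter; length; _++_; concatMap;
  cartesianProduct; deduplicate; take; zipWith)
import Data.List as List
open import Data.List.Properties as List
  using (length-map; length-++; length-removeAt′)
open import Data.List.Membership.Propositional using (_∈_; find; lose)
open import Data.List.Membership.Propositional.Properties
open import Data.List.Relation.Binary.Subset.Propositional using (_⊆_)
open import Data.List.Relation.Unary.All as All using (All; []; _∷_)
open import Data.List.Relation.Unary.All.Properties as All using ()
open import Data.List.Relation.Unary.Any as Any using (Any; here; there; index; _─_; any?)
open import Data.List.Relation.Unary.Any.Properties using (¬Any[])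
open import Data.List.Relation.Unary.AllPairs using ([]; _∷_)
open import Data.List.Relation.Unary.Unique.Propositional using (Unique)
import Data.List.Relation.Unary.Unique.DecPropositional.Properties as UniqueDec
import Data.List.Relation.Unary.Unique.Propositional.Properties as Unique
open import Data.Nat
  using (ℕ; zero; suc; _+_; _*_; _/_; _%_; ⌈_/2⌉; _∸_; _≤_; _<_; _≟_; _≤?_; _<?_; z≤n; s≤s)
open import Data.Nat.Properties hiding (_≟_; _≤?_; _<?_)
open import Algebra.Properties.CommutativeSemigroup +-commutativeSemigroup
  using () renaming (interchange to +-interchange)
open import Data.Nat.DivMod using (m<n*o⇒m/o<n; m≡m%n+[m/n]*n; m%n<n)
open import Data.Nat.Combinatorics using (_C_; nC1≡n; nCk+nC[k+1]≡[n+1]C[k+1])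
open import Data.Product using (_×_; _,_; proj₁; proj₂; ∃-syntax)
open import Data.Product.Properties using (≡-dec)
open import Data.Sum using (_⊎_; inj₁; inj₂; [_,_]′)
open import Data.Vec as Vec using (Vec; []; _∷_; replicate) renaming (_++_ to _++ᵛ_)
import Data.Vec.Properties as Vecₚ
open import Data.Vec.Relation.Binary.Pointwise.Inductive as Pointwise using ([]; _∷_)
open import Function using (_∘_)
open import Function.Bundles using (_⇔_; mk⇔)
open import Relation.Binary.Definitions using (DecidableEquality)
open import Relation.Binary.PropositionalEquality
open import Relation.Nullary using (¬_; Dec; yes; no; contradiction; ¬?; _×-dec_)

private variable s t : ℕ

module _ {A : Set} where

  ≢[]⇒∃∈ : ∀ {xs : List A} → xs ≢ [] → ∃[ x ] x ∈ xs
  ≢[]⇒∃∈ {[]}    xs≢[] = contradiction refl xs≢[]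
  ≢[]⇒∃∈ {x ∷ _} _     = x , here refl

  ∈-─⁺ : ∀ {x y} {ys : List A} (x∈ys : x ∈ ys) → y ∈ ys → y ≢ x → y ∈ (ys ─ x∈ys)
  ∈-─⁺ (here refl) (here refl) y≢x = contradiction refl y≢x
  ∈-─⁺ (here _)    (there y∈)  _   = y∈
  ∈-─⁺ (there _)   (here refl) _   = here refl
  ∈-─⁺ (there x∈)  (there y∈)  y≢x = there (∈-─⁺ x∈ y∈ y≢x)

  Unique-⊆⇒length≤ : ∀ {xs ys : List A} → Unique xs → xs ⊆ ys → length xs ≤ length ys
  Unique-⊆⇒length≤ {[]}     _             _     = z≤n
  Unique-⊆⇒length≤ {x ∷ xs} {ys} (x∉xs ∷ !xs) xs⊆ys = begin
    suc (length xs)          ≤⟨ s≤s (Unique-⊆⇒length≤ !xs xs⊆ys─x) ⟩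
    suc (length (ys ─ x∈ys)) ≡⟨ length-removeAt′ ys (index x∈ys) ⟨
    length ys                ∎
    where
    open ≤-Reasoning
    x∈ys = xs⊆ys (here refl)
    xs⊆ys─x : xs ⊆ (ys ─ x∈ys)
    xs⊆ys─x y∈xs = ∈-─⁺ x∈ys (xs⊆ys (there y∈xs)) λ { refl → All.lookup x∉xs y∈xs refl }

  Unique-⊆-⊇⇒length≡ : ∀ {xs ys : List A} → Unique xs → Unique ys → xs ⊆ ys → ys ⊆ xs →
                       length xs ≡ length ys
  Unique-⊆-⊇⇒length≡ !xs !ys xs⊆ys ys⊆xs =
    ≤-antisym (Unique-⊆⇒length≤ !xs xs⊆ys) (Unique-⊆⇒length≤ !ys ys⊆xs)

  module _ (_≟ᴬ_ : DecidableEquality A) where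
    open import Data.List.Membership.DecPropositional _≟ᴬ_ using (_∈?_)

    Unique-⊆-length≥⇒⊇ : ∀ {xs ys : List A} → Unique xs → xs ⊆ ys → length ys ≤ length xs → ys ⊆ xs
    Unique-⊆-length≥⇒⊇ {xs} {ys} !xs xs⊆ys ys≤xs {y} y∈ys with y ∈? xs
    ... | yes y∈xs = y∈xs
    ... | no  y∉xs = contradiction (begin-strict
      length xs                ≤⟨ Unique-⊆⇒length≤ !xs xs⊆ys─y ⟩
      length (ys ─ y∈ys)       <⟨ n<1+n _ ⟩
      suc (length (ys ─ y∈ys)) ≡⟨ length-removeAt′ ys (index y∈ys) ⟨
      length ys                ≤⟨ ys≤xs ⟩
      length xs                ∎) (<-irrefl refl)
      where
      open ≤-Reasoning
      xs⊆ys─y : xs ⊆ (ys ─ y∈ys)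
      xs⊆ys─y x∈xs = ∈-─⁺ y∈ys (xs⊆ys x∈xs) λ { refl → y∉xs x∈xs }

module _ {A B : Set} where

  Unique-map⁺ : ∀ (f : A → B) {xs} → Unique xs →
                (∀ {x y} → x ∈ xs → y ∈ xs → f x ≡ f y → x ≡ y) → Unique (map f xs)
  Unique-map⁺ f {[]}     _            _     = []
  Unique-map⁺ f {x ∷ xs} (x∉xs ∷ !xs) f-inj =
    All.tabulate (λ fy∈ fx≡fy → let (y , y∈ , fy≡) = ∈-map⁻ f fy∈ in
                   All.lookup x∉xs y∈ (f-inj (here refl) (there y∈) (trans fx≡fy fy≡)))
    ∷ Unique-map⁺ f !xs (λ x∈ y∈ → f-inj (there x∈) (there y∈))

  length-cartesianProduct : ∀ (xs : List A) (ys : List B) →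
                            length (cartesianProduct xs ys) ≡ length xs * length ys
  length-cartesianProduct []       ys = refl
  length-cartesianProduct (x ∷ xs) ys = begin
    length (map (x ,_) ys ++ cartesianProduct xs ys) ≡⟨ length-++ (map (x ,_) ys) ⟩
    length (map (x ,_) ys) + length (cartesianProduct xs ys)
      ≡⟨ cong₂ _+_ (length-map (x ,_) ys) (length-cartesianProduct xs ys) ⟩
    length ys + length xs * length ys ∎
    where open ≡-Reasoning

module _ {A : Set} where

  take⊆ : ∀ n (xs : List A) → take n xs ⊆ xs
  take⊆ (suc n) (x ∷ xs) (here refl) = here refl
  take⊆ (suc n) (x ∷ xs) (there y∈)  = there (take⊆ n xs y∈)

  take-mono : ∀ {m n} (xs : List A) → m ≤ n → take m xs ⊆ take n xs
  take-mono (x ∷ xs) (s≤s m≤n) (here refl) = here refl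
  take-mono (x ∷ xs) (s≤s m≤n) (there y∈)  = there (take-mono xs m≤n y∈)

  ∈-take-filter⁺ : ∀ {P : A → Set} (P? : ∀ x → Dec (P x)) n (xs : List A) {y} →
                   y ∈ take n xs → P y → y ∈ take n (filter P? xs)
  ∈-take-filter⁺ P? (suc n) (x ∷ xs) y∈ py with P? x
  ∈-take-filter⁺ P? (suc n) (x ∷ xs) (here refl) py | yes _  = here refl
  ∈-take-filter⁺ P? (suc n) (x ∷ xs) (there y∈)  py | yes _  = there (∈-take-filter⁺ P? n xs y∈ py)
  ∈-take-filter⁺ P? (suc n) (x ∷ xs) (here refl) py | no ¬px = contradiction py ¬px
  ∈-take-filter⁺ P? (suc n) (x ∷ xs) (there y∈)  py | no _   =
    take-mono (filter P? xs) (n≤1+n n) (∈-take-filter⁺ P? n xs y∈ py)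

  ∈-take-deduplicate-++ : (_≟ᴬ_ : DecidableEquality A) (xs ys : List A) {y : A} → y ∈ xs →
                          y ∈ take (length xs) (deduplicate _≟ᴬ_ (xs ++ ys))
  ∈-take-deduplicate-++ _≟ᴬ_ (x ∷ xs) ys (here refl) = here refl
  ∈-take-deduplicate-++ _≟ᴬ_ (x ∷ xs) ys {y} (there y∈) with y ≟ᴬ x
  ... | yes refl = here refl
  ... | no  y≢x  = there (∈-take-filter⁺ (λ z → ¬? (x ≟ᴬ z)) (length xs) _
                            (∈-take-deduplicate-++ _≟ᴬ_ xs ys y∈) (λ x≡y → y≢x (sym x≡y)))

  tokens : List A → List (A × Bool)
  tokens xs = cartesianProduct xs (true ∷ false ∷ [])

  ∈-tokens⁺ : ∀ {x xs} b → x ∈ xs → (x , b) ∈ tokens xs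
  ∈-tokens⁺ true  x∈ = ∈-cartesianProduct⁺ x∈ (here refl)
  ∈-tokens⁺ false x∈ = ∈-cartesianProduct⁺ x∈ (there (here refl))

  ∈-tokens⁻ : ∀ {x b} xs → (x , b) ∈ tokens xs → x ∈ xs
  ∈-tokens⁻ xs xb∈ = proj₁ (∈-cartesianProduct⁻ xs _ xb∈)

  Unique-tokens : ∀ {xs} → Unique xs → Unique (tokens xs)
  Unique-tokens !xs = Unique.cartesianProduct⁺ !xs (((λ ()) ∷ []) ∷ [] ∷ [])

  length-tokens : ∀ xs → length (tokens xs) ≡ length xs * 2
  length-tokens xs = length-cartesianProduct xs (true ∷ false ∷ [])

infixr 7 _·_

_·_ : Monomial s → Monomial s → Monomial s
_·_ = Vec.zipWith _+_

1ᵐ : Monomial s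
1ᵐ = replicate _ 0

IsVar : Monomial s → Set
IsVar x = deg x ≡ 1

·-comm : (u v : Monomial s) → u · v ≡ v · u
·-comm = Vecₚ.zipWith-comm +-comm

·-assoc : (u v w : Monomial s) → (u · v) · w ≡ u · v · w
·-assoc = Vecₚ.zipWith-assoc +-assoc

·-identityʳ : (u : Monomial s) → u · 1ᵐ ≡ u
·-identityʳ = Vecₚ.zipWith-identityʳ +-identityʳ

·-identityˡ : (u : Monomial s) → 1ᵐ · u ≡ u
·-identityˡ = Vecₚ.zipWith-identityˡ +-identityˡ

·-cancelˡ : (u v w : Monomial s) → u · v ≡ u · w → v ≡ w
·-cancelˡ [] [] [] _ = refl
·-cancelˡ (a ∷ u) (b ∷ v) (c ∷ w) eq =
  cong₂ _∷_ (+-cancelˡ-≡ a b c (Vecₚ.∷-injectiveˡ eq)) (·-cancelˡ u v w (Vecₚ.∷-injectiveʳ eq))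

·-exchange : (u v w : Monomial s) → u · v · w ≡ v · u · w
·-exchange u v w = trans (sym (·-assoc u v w)) (trans (cong (_· w) (·-comm u v)) (·-assoc v u w))

·-swap₂₃ : (x y z : Monomial s) → x · y · z ≡ x · z · y
·-swap₂₃ x y z = cong (x ·_) (·-comm y z)

deg-· : (u v : Monomial s) → deg (u · v) ≡ deg u + deg v
deg-· [] [] = refl
deg-· (a ∷ u) (b ∷ v) = trans (cong (a + b +_) (deg-· u v)) (+-interchange a b (deg u) (deg v))

deg-1ᵐ : ∀ s → deg (1ᵐ {s}) ≡ 0
deg-1ᵐ zero    = refl
deg-1ᵐ (suc s) = deg-1ᵐ s

deg≡0⇒≡1ᵐ : (u : Monomial s) → deg u ≡ 0 → u ≡ 1ᵐ
deg≡0⇒≡1ᵐ []          _  = refl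
deg≡0⇒≡1ᵐ (zero ∷ u)  eq = cong (0 ∷_) (deg≡0⇒≡1ᵐ u eq)

∣ᵐ-refl : (u : Monomial s) → u ∣ᵐ u
∣ᵐ-refl _ = Pointwise.refl ≤-refl

∣ᵐ-trans : {u v w : Monomial s} → u ∣ᵐ v → v ∣ᵐ w → u ∣ᵐ w
∣ᵐ-trans = Pointwise.trans ≤-trans

u∣u·v : (u v : Monomial s) → u ∣ᵐ (u · v)
u∣u·v []      []      = []
u∣u·v (a ∷ u) (b ∷ v) = m≤m+n a b ∷ u∣u·v u v

v∣u·v : (u v : Monomial s) → v ∣ᵐ (u · v)
v∣u·v u v = subst (v ∣ᵐ_) (·-comm v u) (u∣u·v v u)

x·y∣x·y·z : (x y z : Monomial s) → (x · y) ∣ᵐ (x · y · z)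
x·y∣x·y·z x y z = subst ((x · y) ∣ᵐ_) (·-assoc x y z) (u∣u·v (x · y) z)

1ᵐ∣u : (u : Monomial s) → 1ᵐ ∣ᵐ u
1ᵐ∣u []      = []
1ᵐ∣u (_ ∷ u) = z≤n ∷ 1ᵐ∣u u

∣ᵐ⇒deg≤ : {u v : Monomial s} → u ∣ᵐ v → deg u ≤ deg v
∣ᵐ⇒deg≤ []       = z≤n
∣ᵐ⇒deg≤ (p ∷ ps) = +-mono-≤ p (∣ᵐ⇒deg≤ ps)

∣ᵐ∧deg≡⇒≡ : {u v : Monomial s} → u ∣ᵐ v → deg u ≡ deg v → u ≡ v
∣ᵐ∧deg≡⇒≡ []                          _  = refl
∣ᵐ∧deg≡⇒≡ {u = a ∷ u} {v = b ∷ v} (a≤b ∷ u∣v) eq = cong₂ _∷_ a≡b (∣ᵐ∧deg≡⇒≡ u∣v degu≡degv)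
  where
  a≡b : a ≡ b
  a≡b = ≤-antisym a≤b (+-cancelʳ-≤ (deg v) b a (begin
    b + deg v ≡⟨ eq ⟨
    a + deg u ≤⟨ +-monoʳ-≤ a (∣ᵐ⇒deg≤ u∣v) ⟩
    a + deg v ∎))
    where open ≤-Reasoning
  degu≡degv : deg u ≡ deg v
  degu≡degv = +-cancelˡ-≡ a (deg u) (deg v) (trans eq (cong (_+ deg v) (sym a≡b)))

∣ᵐ⇒∃· : {x u : Monomial s} → x ∣ᵐ u → ∃[ w ] u ≡ x · w
∣ᵐ⇒∃· []       = [] , refl
∣ᵐ⇒∃· {x = a ∷ x} {u = b ∷ u} (a≤b ∷ x∣u) =
  let (w , u≡x·w) = ∣ᵐ⇒∃· x∣u in b ∸ a ∷ w , cong₂ _∷_ (sym (m+[n∸m]≡n a≤b)) u≡x·w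

_≟ᵐ_ : DecidableEquality (Monomial s)
_≟ᵐ_ = Vecₚ.≡-dec _≟_

_∣?_ : (u v : Monomial s) → Dec (u ∣ᵐ v)
_∣?_ = Pointwise.decidable _≤?_

deg≡0⇒∣ᵐ : (x u : Monomial s) → deg x ≡ 0 → x ∣ᵐ u
deg≡0⇒∣ᵐ x u eq = subst (_∣ᵐ u) (sym (deg≡0⇒≡1ᵐ x eq)) (1ᵐ∣u u)

∣ᵐ1ᵐ⇒≡1ᵐ : {w : Monomial s} → w ∣ᵐ 1ᵐ → w ≡ 1ᵐ
∣ᵐ1ᵐ⇒≡1ᵐ {s} {w} w∣1 = deg≡0⇒≡1ᵐ w (n≤0⇒n≡0 (subst (deg w ≤_) (deg-1ᵐ s) (∣ᵐ⇒deg≤ w∣1)))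

var-prime : (x u v : Monomial s) → IsVar x → x ∣ᵐ (u · v) → x ∣ᵐ u ⊎ x ∣ᵐ v
var-prime (zero ∷ x) (a ∷ u) (b ∷ v) vx (_ ∷ x∣uv) with var-prime x u v vx x∣uv
... | inj₁ x∣u = inj₁ (z≤n ∷ x∣u)
... | inj₂ x∣v = inj₂ (z≤n ∷ x∣v)
var-prime (1 ∷ x) (zero  ∷ u) (b ∷ v) vx (1≤b ∷ _) = inj₂ (1≤b ∷ deg≡0⇒∣ᵐ x v (suc-injective vx))
var-prime (1 ∷ x) (suc a ∷ u) (b ∷ v) vx _         = inj₁ (s≤s z≤n ∷ deg≡0⇒∣ᵐ x u (suc-injective vx))

var-∣-var : {x y : Monomial s} → IsVar x → IsVar y → x ∣ᵐ y → x ≡ y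
var-∣-var vx vy x∣y = ∣ᵐ∧deg≡⇒≡ x∣y (trans vx (sym vy))

vars-·-injective : {x y p q : Monomial s} → IsVar x → IsVar y → IsVar p → IsVar q →
                   x · y ≡ p · q → (x ≡ p × y ≡ q) ⊎ (x ≡ q × y ≡ p)
vars-·-injective {x = x} {y} {p} {q} vx vy vp vq xy≡pq
  with var-prime x p q vx (subst (x ∣ᵐ_) xy≡pq (u∣u·v x y))
... | inj₁ x∣p = let x≡p = var-∣-var vx vp x∣p in
  inj₁ (x≡p , ·-cancelˡ x y q (trans xy≡pq (cong (_· q) (sym x≡p))))
... | inj₂ x∣q = let x≡q = var-∣-var vx vq x∣q in
  inj₂ (x≡q , ·-cancelˡ x y p (trans xy≡pq (trans (·-comm p q) (cong (_· p) (sym x≡q)))))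

deg-var·var : (x y : Monomial s) → IsVar x → IsVar y → deg (x · y) ≡ 2
deg-var·var x y vx vy = trans (deg-· x y) (cong₂ _+_ vx vy)

var·var-crossed : {x x' t t' : Monomial s} → IsVar x → IsVar x' → IsVar t → IsVar t' →
                  x ≢ x' → x · t ≡ x' · t' → x ≡ t' × t ≡ x'
var·var-crossed vx vx' vt vt' x≢x' xt≡x't' with vars-·-injective vx vt vx' vt' xt≡x't'
... | inj₁ (x≡x' , _) = contradiction x≡x' x≢x'
... | inj₂ crossed    = crossed

prod : List (Monomial s) → Monomial s
prod = foldr _·_ 1ᵐ

var-∣-prod⇒∈ : {x : Monomial s} (xs : List (Monomial s)) → IsVar x → All IsVar xs →
               x ∣ᵐ prod xs → x ∈ xs
var-∣-prod⇒∈ {s = s} [] vx [] x∣1 =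
  contradiction (trans (sym vx) (trans (cong deg (∣ᵐ1ᵐ⇒≡1ᵐ x∣1)) (deg-1ᵐ s))) λ ()
var-∣-prod⇒∈ {x = x} (y ∷ ys) vx (vy ∷ vys) x∣y·ys with var-prime x y (prod ys) vx x∣y·ys
... | inj₁ x∣y  = here (var-∣-var vx vy x∣y)
... | inj₂ x∣ys = there (var-∣-prod⇒∈ ys vx vys x∣ys)

x₀ : Monomial (suc s)
x₀ = 1 ∷ 1ᵐ

varFactors : Monomial s → List (Monomial s)
varFactors []      = []
varFactors (e ∷ u) = List.replicate e x₀ ++ map (0 ∷_) (varFactors u)

prod-++ : (xs ys : List (Monomial s)) → prod (xs ++ ys) ≡ prod xs · prod ys
prod-++ []       ys = sym (·-identityˡ (prod ys))
prod-++ (x ∷ xs) ys = trans (cong (x ·_) (prod-++ xs ys)) (sym (·-assoc x (prod xs) (prod ys)))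

prod-replicate-x₀ : ∀ e → prod (List.replicate e (x₀ {s})) ≡ e ∷ 1ᵐ
prod-replicate-x₀ zero    = refl
prod-replicate-x₀ (suc e) = trans (cong (x₀ ·_) (prod-replicate-x₀ e)) (cong (suc e ∷_) (·-identityʳ 1ᵐ))

prod-map-0∷ : (xs : List (Monomial s)) → prod (map (0 ∷_) xs) ≡ 0 ∷ prod xs
prod-map-0∷ []       = refl
prod-map-0∷ (x ∷ xs) = cong ((0 ∷ x) ·_) (prod-map-0∷ xs)

prod-varFactors : (u : Monomial s) → prod (varFactors u) ≡ u
prod-varFactors []      = refl
prod-varFactors (e ∷ u) = begin
  prod (List.replicate e x₀ ++ map (0 ∷_) (varFactors u))
    ≡⟨ prod-++ (List.replicate e x₀) (map (0 ∷_) (varFactors u)) ⟩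
  prod (List.replicate e x₀) · prod (map (0 ∷_) (varFactors u))
    ≡⟨ cong₂ _·_ (prod-replicate-x₀ e) (prod-map-0∷ (varFactors u)) ⟩
  (e ∷ 1ᵐ) · (0 ∷ prod (varFactors u))
    ≡⟨ cong₂ _∷_ (+-identityʳ e) (trans (·-identityˡ _) (prod-varFactors u)) ⟩
  e ∷ u ∎
  where open ≡-Reasoning

varFactors-vars : (u : Monomial s) → All IsVar (varFactors u)
varFactors-vars []                = []
varFactors-vars {suc s} (e ∷ u) =
  All.++⁺ (All.replicate⁺ e (cong suc (deg-1ᵐ s))) (All.map⁺ (varFactors-vars u))

length-varFactors : (u : Monomial s) → length (varFactors u) ≡ deg u
length-varFactors []      = refl
length-varFactors (e ∷ u) = begin
  length (List.replicate e x₀ ++ map (0 ∷_) (varFactors u))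
    ≡⟨ length-++ (List.replicate e x₀) ⟩
  length (List.replicate e x₀) + length (map (0 ∷_) (varFactors u))
    ≡⟨ cong₂ _+_ (List.length-replicate e) (trans (length-map _ (varFactors u)) (length-varFactors u)) ⟩
  e + deg u ∎
  where open ≡-Reasoning

var-∣⇒∈varFactors : {x : Monomial s} (u : Monomial s) → IsVar x → x ∣ᵐ u → x ∈ varFactors u
var-∣⇒∈varFactors u vx x∣u =
  var-∣-prod⇒∈ (varFactors u) vx (varFactors-vars u) (subst (_ ∣ᵐ_) (sym (prod-varFactors u)) x∣u)

deg≡2⇒var·var : (u : Monomial s) → deg u ≡ 2 → ∃[ x ] ∃[ y ] IsVar x × IsVar y × u ≡ x · y
deg≡2⇒var·var u du
  with varFactors u | length-varFactors u | varFactors-vars u | prod-varFactors u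
... | x ∷ y ∷ []    | _   | vx ∷ vy ∷ [] | eq =
  x , y , vx , vy , trans (sym eq) (cong (x ·_) (·-identityʳ y))
... | []            | len | _ | _ = contradiction (trans len du) λ ()
... | _ ∷ []        | len | _ | _ = contradiction (trans len du) λ ()
... | _ ∷ _ ∷ _ ∷ _ | len | _ | _ = contradiction (trans len du) λ ()

ofDeg : List (Monomial s) → ℕ → List (Monomial s)
ofDeg A i = filter (λ u → deg u ≟ i) A

module _ {A : List (Monomial s)} where

  ∈-ofDeg⁺ : ∀ {u} i → u ∈ A → deg u ≡ i → u ∈ ofDeg A i
  ∈-ofDeg⁺ i = ∈-filter⁺ (λ u → deg u ≟ i)

  ∈-ofDeg⁻ : ∀ {u} i → u ∈ ofDeg A i → u ∈ A × deg u ≡ i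
  ∈-ofDeg⁻ i = ∈-filter⁻ (λ u → deg u ≟ i)

  Unique-ofDeg : ∀ i → Unique A → Unique (ofDeg A i)
  Unique-ofDeg i = Unique.filter⁺ (λ u → deg u ≟ i)

maxDeg-upperBound : {A : List (Monomial s)} {u : Monomial s} → u ∈ A → deg u ≤ maxDeg A
maxDeg-upperBound {A = x ∷ A} (here refl) = m≤m⊔n (deg x) (maxDeg A)
maxDeg-upperBound {A = x ∷ A} (there u∈A) = ≤-trans (maxDeg-upperBound u∈A) (m≤n⊔m (deg x) (maxDeg A))

maxDeg-attained : (A : List (Monomial s)) → A ≢ [] → ∃[ m ] m ∈ A × deg m ≡ maxDeg A
maxDeg-attained []      A≢[] = contradiction refl A≢[]
maxDeg-attained (x ∷ A) _    = attained x A
  where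
  attained : ∀ x A → ∃[ m ] m ∈ x ∷ A × deg m ≡ maxDeg (x ∷ A)
  attained x []      = x , here refl , sym (⊔-identityʳ (deg x))
  attained x (y ∷ A) = [ (λ x-wins → x , here refl , sym x-wins)
                       , (λ A-wins → let (m , m∈ , dm) = attained y A in
                                     m , there m∈ , trans dm (sym A-wins)) ]′
                       (⊔-sel (deg x) (maxDeg (y ∷ A)))

∣ᵐ-≢⇒deg< : {u w : Monomial s} → u ∣ᵐ w → w ≢ u → deg u < deg w
∣ᵐ-≢⇒deg< u∣w w≢u = ≤∧≢⇒< (∣ᵐ⇒deg≤ u∣w) λ eq → w≢u (sym (∣ᵐ∧deg≡⇒≡ u∣w eq))

module _ (A : List (Monomial s)) where

  private
    -- k is fuel: each step strictly raises the degree, which is bounded by maxDeg A.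
    maximal-above : ∀ k {u} → u ∈ A → maxDeg A ∸ deg u ≤ k → ∃[ m ] IsMaximal A m × u ∣ᵐ m
    maximal-above k {u} u∈A gap with any? (λ w → (u ∣? w) ×-dec ¬? (w ≟ᵐ u)) A
    ... | no ∄w = u , (u∈A , u-maximal) , ∣ᵐ-refl u
      where
      u-maximal : ∀ {w} → w ∈ A → u ∣ᵐ w → w ≡ u
      u-maximal {w} w∈A u∣w with w ≟ᵐ u
      ... | yes w≡u = w≡u
      ... | no  w≢u = contradiction (lose w∈A (u∣w , w≢u)) ∄w
    ... | yes ∃w with find ∃w
    ... | w , w∈A , u∣w , w≢u with k
    ...   | zero  = contradiction (≤-trans deg-u<deg-w deg-w≤deg-u) (<-irrefl refl)
      where
      deg-u<deg-w = ∣ᵐ-≢⇒deg< u∣w w≢u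
      deg-w≤deg-u = ≤-trans (maxDeg-upperBound w∈A) (m∸n≡0⇒m≤n (n≤0⇒n≡0 gap))
    ...   | suc k =
      let (m , m-max , w∣m) = maximal-above k w∈A
            (≤-pred (≤-trans (∸-monoʳ-< (∣ᵐ-≢⇒deg< u∣w w≢u) (maxDeg-upperBound w∈A)) gap))
      in m , m-max , ∣ᵐ-trans u∣w w∣m

  ∃-maximal-above : ∀ {u} → u ∈ A → ∃[ m ] IsMaximal A m × u ∣ᵐ m
  ∃-maximal-above {u} u∈A = maximal-above (maxDeg A ∸ deg u) u∈A ≤-refl

top-degree⇒maximal : {A : List (Monomial s)} {m : Monomial s} → m ∈ A → deg m ≡ maxDeg A → IsMaximal A m
top-degree⇒maximal {m = m} m∈A dm = m∈A , λ {w} w∈A m∣w →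
  sym (∣ᵐ∧deg≡⇒≡ m∣w (≤-antisym (∣ᵐ⇒deg≤ m∣w) (subst (deg w ≤_) (sym dm) (maxDeg-upperBound w∈A))))

maximal-degrees⇒maxDeg≡ : {A : List (Monomial s)} {n : ℕ} → A ≢ [] →
                          (∀ {u} → IsMaximal A u → deg u ≡ n) → maxDeg A ≡ n
maximal-degrees⇒maxDeg≡ {A = A} A≢[] maximal-deg =
  let (m , m∈A , dm) = maxDeg-attained A A≢[] in trans (sym dm) (maximal-deg (top-degree⇒maximal m∈A dm))

module _ {A : List (Monomial s)} (ideal : IsOrderIdeal A) where
  open IsOrderIdeal ideal

  1ᵐ∈ideal : 1ᵐ ∈ A
  1ᵐ∈ideal = let (u , u∈A) = ≢[]⇒∃∈ nonempty in downClosed u∈A (1ᵐ∣u u)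

  countDeg0≡1 : countDeg A 0 ≡ 1
  countDeg0≡1 = Unique-⊆-⊇⇒length≡ (Unique-ofDeg 0 unique) ([] ∷ []) deg0⇒1ᵐ 1ᵐ∈ofDeg0
    where
    deg0⇒1ᵐ : ofDeg A 0 ⊆ 1ᵐ ∷ []
    deg0⇒1ᵐ u∈ = here (deg≡0⇒≡1ᵐ _ (proj₂ (∈-ofDeg⁻ {A = A} 0 u∈)))
    1ᵐ∈ofDeg0 : 1ᵐ ∷ [] ⊆ ofDeg A 0
    1ᵐ∈ofDeg0 (here refl) = ∈-ofDeg⁺ 0 1ᵐ∈ideal (deg-1ᵐ s)

  module _ (pure : IsPure A) where

    maximal⇒deg≡maxDeg : ∀ {u} → IsMaximal A u → deg u ≡ maxDeg A
    maximal⇒deg≡maxDeg u-max =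
      let (m , m∈A , dm) = maxDeg-attained A nonempty in trans (pure u-max (top-degree⇒maximal m∈A dm)) dm

    ∃-top-multiple : ∀ {u} → u ∈ A → ∃[ m ] m ∈ A × u ∣ᵐ m × deg m ≡ maxDeg A
    ∃-top-multiple u∈A =
      let (m , m-max , u∣m) = ∃-maximal-above A u∈A in m , proj₁ m-max , u∣m , maximal⇒deg≡maxDeg m-max

-- The bounds h₁ ≤ n hₙ and h₂ ≤ (h₁ + 1) choose 2

length-concatMap-varFactors : ∀ {n} (ms : List (Monomial s)) → All (λ m → deg m ≡ n) ms →
                              length (concatMap varFactors ms) ≡ n * length ms
length-concatMap-varFactors {n = n} []       []         = sym (*-zeroʳ n)
length-concatMap-varFactors {n = n} (m ∷ ms) (dm ∷ dms) = begin
  length (varFactors m ++ concatMap varFactors ms)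
    ≡⟨ length-++ (varFactors m) ⟩
  length (varFactors m) + length (concatMap varFactors ms)
    ≡⟨ cong₂ _+_ (trans (length-varFactors m) dm) (length-concatMap-varFactors ms dms) ⟩
  n + n * length ms
    ≡⟨ *-suc n (length ms) ⟨
  n * suc (length ms) ∎
  where open ≡-Reasoning

countDeg1≤maxDeg*countTop : {A : List (Monomial s)} → IsOrderIdeal A → IsPure A →
                            countDeg A 1 ≤ maxDeg A * countDeg A (maxDeg A)
countDeg1≤maxDeg*countTop {A = A} ideal pure = begin
  countDeg A 1                          ≤⟨ Unique-⊆⇒length≤ (Unique-ofDeg 1 unique) vars⊆ ⟩
  length (concatMap varFactors tops)    ≡⟨ length-concatMap-varFactors tops tops-deg ⟩
  maxDeg A * countDeg A (maxDeg A)      ∎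
  where
  open ≤-Reasoning
  open IsOrderIdeal ideal
  tops = ofDeg A (maxDeg A)
  tops-deg : All (λ m → deg m ≡ maxDeg A) tops
  tops-deg = All.tabulate λ m∈ → proj₂ (∈-ofDeg⁻ {A = A} (maxDeg A) m∈)
  vars⊆ : ofDeg A 1 ⊆ concatMap varFactors tops
  vars⊆ x∈ =
    let (x∈A , vx) = ∈-ofDeg⁻ 1 x∈
        (m , m∈A , x∣m , dm) = ∃-top-multiple ideal pure x∈A
    in ∈-concatMap⁺ varFactors (lose (∈-ofDeg⁺ (maxDeg A) m∈A dm) (var-∣⇒∈varFactors m vx x∣m))

pairProducts : List (Monomial s) → List (Monomial s)
pairProducts []       = []
pairProducts (x ∷ xs) = map (x ·_) (x ∷ xs) ++ pairProducts xs

∈-pairProducts⁺ : ∀ {x y} (xs : List (Monomial s)) → x ∈ xs → y ∈ xs → x · y ∈ pairProducts xs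
∈-pairProducts⁺ (z ∷ xs) (here refl) y∈ = ∈-++⁺ˡ (∈-map⁺ (z ·_) y∈)
∈-pairProducts⁺ {x = x} (z ∷ xs) (there x∈) (here refl) =
  subst (_∈ pairProducts (z ∷ xs)) (·-comm z x) (∈-++⁺ˡ (∈-map⁺ (z ·_) (there x∈)))
∈-pairProducts⁺ (z ∷ xs) (there x∈) (there y∈) = ∈-++⁺ʳ (map (z ·_) (z ∷ xs)) (∈-pairProducts⁺ xs x∈ y∈)

∈-pairProducts⁻ : ∀ {v} (xs : List (Monomial s)) → v ∈ pairProducts xs →
                  ∃[ x ] ∃[ y ] x ∈ xs × y ∈ xs × v ≡ x · y
∈-pairProducts⁻ (x ∷ xs) v∈ with ∈-++⁻ (map (x ·_) (x ∷ xs)) v∈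
... | inj₁ v∈x·xs = let (y , y∈ , v≡) = ∈-map⁻ (x ·_) v∈x·xs in x , y , here refl , y∈ , v≡
... | inj₂ v∈xs   = let (y , z , y∈ , z∈ , v≡) = ∈-pairProducts⁻ xs v∈xs in
  y , z , there y∈ , there z∈ , v≡

length-pairProducts : (xs : List (Monomial s)) → length (pairProducts xs) ≡ suc (length xs) C 2
length-pairProducts []       = refl
length-pairProducts (x ∷ xs) = begin
  length (map (x ·_) (x ∷ xs) ++ pairProducts xs)
    ≡⟨ length-++ (map (x ·_) (x ∷ xs)) ⟩
  length (map (x ·_) (x ∷ xs)) + length (pairProducts xs)
    ≡⟨ cong₂ _+_ (trans (length-map (x ·_) (x ∷ xs)) (sym (nC1≡n (suc (length xs))))) (length-pairProducts xs) ⟩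
  suc (length xs) C 1 + suc (length xs) C 2
    ≡⟨ nCk+nC[k+1]≡[n+1]C[k+1] (suc (length xs)) 1 ⟩
  suc (suc (length xs)) C 2 ∎
  where open ≡-Reasoning

countDeg2≤choose : {A : List (Monomial s)} → IsOrderIdeal A → countDeg A 2 ≤ suc (countDeg A 1) C 2
countDeg2≤choose {A = A} ideal = begin
  countDeg A 2                            ≤⟨ Unique-⊆⇒length≤ (Unique-ofDeg 2 unique) quadratics⊆ ⟩
  length (pairProducts (ofDeg A 1))       ≡⟨ length-pairProducts (ofDeg A 1) ⟩
  suc (countDeg A 1) C 2                  ∎
  where
  open ≤-Reasoning
  open IsOrderIdeal ideal
  quadratics⊆ : ofDeg A 2 ⊆ pairProducts (ofDeg A 1)
  quadratics⊆ {q} q∈ with ∈-ofDeg⁻ 2 q∈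
  ... | q∈A , dq with deg≡2⇒var·var q dq
  ... | x , y , vx , vy , refl = ∈-pairProducts⁺ (ofDeg A 1)
    (∈-ofDeg⁺ 1 (downClosed q∈A (u∣u·v x y)) vx) (∈-ofDeg⁺ 1 (downClosed q∈A (v∣u·v x y)) vy)

-- The bound h₃ ≤ h₁ for h-vectors (1, h₁, h₁, h₃)

-- Lexicographic comparison, used only as a tie-break between two distinct monomials.
precedes : Monomial s → Monomial s → Bool
precedes []      []      = false
precedes (a ∷ u) (c ∷ v) with a <? c | c <? a
... | yes _ | _     = true
... | no  _ | yes _ = false
... | no  _ | no  _ = precedes u v

precedes-antisym : (u v : Monomial s) → u ≢ v → precedes u v ≢ precedes v u
precedes-antisym []      []      u≢v = λ _ → u≢v refl
precedes-antisym (a ∷ u) (c ∷ v) u≢v with a <? c | c <? a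
... | yes a<c | yes c<a = λ _ → <-asym a<c c<a
... | yes _   | no  _   = λ ()
... | no  _   | yes _   = λ ()
... | no  a≮c | no  c≮a with ≤-antisym (≮⇒≥ c≮a) (≮⇒≥ a≮c)
...   | refl = precedes-antisym u v (λ u≡v → u≢v (cong (a ∷_) u≡v))

data Shape (m c : Monomial s) : Set where
  cube     : m ≡ c · c · c → Shape m c
  square   : ∀ d → IsVar d → d ≢ c → m ≡ d · d · c → Shape m c
  distinct : ∀ p q → IsVar p → IsVar q → c ≢ p → c ≢ q → p ≢ q → m ≡ c · p · q → Shape m c

Shape⇒∣ : {m c : Monomial s} → Shape m c → c ∣ᵐ m
Shape⇒∣ {c = c} (cube refl)                   = u∣u·v c (c · c)
Shape⇒∣ {c = c} (square d _ _ refl)           = ∣ᵐ-trans (v∣u·v d c) (v∣u·v d (d · c))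
Shape⇒∣ {c = c} (distinct p q _ _ _ _ _ refl) = u∣u·v c (p · q)

centre₃ : Monomial s → Monomial s → Monomial s → Monomial s
centre₃ x y z with x ≟ᵐ y | y ≟ᵐ z
... | yes _ | _     = z
... | no  _ | yes _ = x
... | no  _ | no  _ = y

Shape-centre₃ : (x y z : Monomial s) → IsVar x → IsVar y → IsVar z →
                Shape (x · y · z) (centre₃ x y z) × IsVar (centre₃ x y z)
Shape-centre₃ x y z vx vy vz with x ≟ᵐ y | y ≟ᵐ z
Shape-centre₃ x _ z vx _ vz | yes refl | _ with x ≟ᵐ z
... | yes refl = cube refl , vz
... | no  x≢z  = square x vx x≢z refl , vz
Shape-centre₃ x y _ vx vy _ | no x≢y | yes refl =
  square y vy (λ y≡x → x≢y (sym y≡x)) (trans (·-comm x (y · y)) (·-assoc y y x)) , vx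
Shape-centre₃ x y z vx vy vz | no x≢y | no y≢z with x ≟ᵐ z
... | yes refl = square x vx x≢y (·-swap₂₃ x y x) , vy
... | no  x≢z  = distinct x z vx vz (λ y≡x → x≢y (sym y≡x)) y≢z x≢z (·-exchange x y z) , vy

centre : Monomial s → Monomial s
centre m with varFactors m
... | x ∷ y ∷ z ∷ [] = centre₃ x y z
... | _              = 1ᵐ

Shape-centre : (m : Monomial s) → deg m ≡ 3 → Shape m (centre m) × IsVar (centre m)
Shape-centre m dm
  with varFactors m | length-varFactors m | varFactors-vars m | prod-varFactors m
... | x ∷ y ∷ z ∷ []    | _   | vx ∷ vy ∷ vz ∷ [] | m≡xyz =
  subst (λ w → Shape w (centre₃ x y z)) (trans (cong (λ w → x · y · w) (sym (·-identityʳ z))) m≡xyz) sh , vc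
  where
  sh = proj₁ (Shape-centre₃ x y z vx vy vz)
  vc = proj₂ (Shape-centre₃ x y z vx vy vz)
... | []                | len | _ | _ = contradiction (trans len dm) λ ()
... | _ ∷ []            | len | _ | _ = contradiction (trans len dm) λ ()
... | _ ∷ _ ∷ []        | len | _ | _ = contradiction (trans len dm) λ ()
... | _ ∷ _ ∷ _ ∷ _ ∷ _ | len | _ | _ = contradiction (trans len dm) λ ()

-- View the variables of A as vertices and its quadratic monomials as edges, x² being a loop at x.
-- Every variable x spends two tokens, each on an edge at x: both on its loop, or both on the
-- edge to a looped neighbour, or one on each edge of a triangle through x.  Tokens are
-- distinct, and as h₁ = h₂ they are exactly the 2 h₂ pairs (edge, bit).  Counting them forces
-- enough rigidity to make the centre map from cubics to variables injective.
module CubicBound {s : ℕ} {A : List (Monomial s)} (ideal : IsOrderIdeal A) (pure : IsPure A)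
                  (maxDeg≡3 : maxDeg A ≡ 3) (h₁≡h₂ : countDeg A 1 ≡ countDeg A 2) where

  open IsOrderIdeal ideal
  open import Data.List.Membership.DecPropositional (_≟ᵐ_ {s}) using (_∈?_)

  vars quads cubics : List (Monomial s)
  vars   = ofDeg A 1
  quads  = ofDeg A 2
  cubics = ofDeg A 3

  ∈vars⁺ : ∀ {x} → x ∈ A → IsVar x → x ∈ vars
  ∈vars⁺ = ∈-ofDeg⁺ 1

  ∈vars⇒IsVar : ∀ {x} → x ∈ vars → IsVar x
  ∈vars⇒IsVar x∈ = proj₂ (∈-ofDeg⁻ {A = A} 1 x∈)

  ∈vars⇒∈A : ∀ {x} → x ∈ vars → x ∈ A
  ∈vars⇒∈A x∈ = proj₁ (∈-ofDeg⁻ {A = A} 1 x∈)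

  x·y·z∈⇒x·y∈ : ∀ {x y z} → x · y · z ∈ A → x · y ∈ A
  x·y·z∈⇒x·y∈ {x} {y} {z} xyz∈ = downClosed xyz∈ (x·y∣x·y·z x y z)

  Looped : Monomial s → Set
  Looped x = x · x ∈ A

  HasLoopedNeighbour : Monomial s → Set
  HasLoopedNeighbour x = ∃[ y ] y ∈ vars × Looped y × x · y ∈ A

  InTriangle : Monomial s → Set
  InTriangle x = Any (λ (y , z) → y ≢ z × x · y · z ∈ A) (cartesianProduct vars vars)

  data Kind (x : Monomial s) : Set where
    loop       : Looped x → Kind x
    nextToLoop : ¬ Looped x → ∀ y → y ∈ vars → Looped y → x · y ∈ A → Kind x
    triangle   : ¬ Looped x → ¬ HasLoopedNeighbour x →
                 ∀ y z → y ∈ vars → z ∈ vars → y ≢ z → x · y · z ∈ A → Kind x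
    stranded   : ¬ Looped x → ¬ HasLoopedNeighbour x → ¬ InTriangle x → Kind x

  private
    ¬HasLoopedNeighbour : ∀ {x} → ¬ Any (λ y → Looped y × x · y ∈ A) vars → ¬ HasLoopedNeighbour x
    ¬HasLoopedNeighbour ∄y (y , y∈ , ly , xy∈) = ∄y (lose y∈ (ly , xy∈))

  kind : (x : Monomial s) → Kind x
  kind x with x · x ∈? A
  ... | yes lx = loop lx
  ... | no ¬lx with any? (λ y → (y · y ∈? A) ×-dec (x · y ∈? A)) vars
  ...   | yes ∃y = let (y , y∈ , ly , xy∈) = find ∃y in nextToLoop ¬lx y y∈ ly xy∈
  ...   | no ∄y with any? (λ (y , z) → ¬? (y ≟ᵐ z) ×-dec (x · y · z ∈? A)) (cartesianProduct vars vars)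
  ...     | yes ∃yz = let ((y , z) , yz∈ , y≢z , xyz∈) = find ∃yz
                          (y∈ , z∈) = ∈-cartesianProduct⁻ vars vars yz∈
                      in triangle ¬lx (¬HasLoopedNeighbour ∄y) y z y∈ z∈ y≢z xyz∈
  ...     | no ∄yz = stranded ¬lx (¬HasLoopedNeighbour ∄y) ∄yz

  -- The vertex at the other end of the edge on which x spends its token b (x itself if stranded).
  partner : (x : Monomial s) → Kind x → Bool → Monomial s
  partner x (loop _)                   _     = x
  partner x (nextToLoop _ y _ _ _)     _     = y
  partner x (triangle _ _ y _ _ _ _ _) true  = y
  partner x (triangle _ _ _ z _ _ _ _) false = z
  partner x (stranded _ _ _)           _     = x

  -- The two tokens spent on an edge xy of a triangle get the bits precedes x y and precedes y x.
  orientation : (x : Monomial s) → Kind x → Bool → Bool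
  orientation x k@(triangle _ _ _ _ _ _ _ _) b = precedes x (partner x k b)
  orientation x _                            b = b

  ψ : Monomial s × Bool → Monomial s × Bool
  ψ (x , b) = x · partner x (kind x) b , orientation x (kind x) b

  -- By purity x divides a cubic x·y·z of A, and y ≢ z as x has no looped neighbour.
  ¬HasLoopedNeighbour⇒¬¬InTriangle : ∀ {x} → x ∈ vars → ¬ HasLoopedNeighbour x → ¬ ¬ InTriangle x
  ¬HasLoopedNeighbour⇒¬¬InTriangle {x} x∈ ¬nbr ∄yz with ∃-top-multiple ideal pure (∈vars⇒∈A x∈)
  ... | m , m∈A , x∣m , dm with ∣ᵐ⇒∃· x∣m
  ... | w , m≡xw with deg≡2⇒var·var w deg-w≡2
    where
    deg-w≡2 : deg w ≡ 2
    deg-w≡2 = +-cancelˡ-≡ 1 (deg w) 2 (begin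
      1 + deg w     ≡⟨ cong (_+ deg w) (∈vars⇒IsVar x∈) ⟨
      deg x + deg w ≡⟨ deg-· x w ⟨
      deg (x · w)   ≡⟨ cong deg m≡xw ⟨
      deg m         ≡⟨ trans dm maxDeg≡3 ⟩
      3             ∎)
      where open ≡-Reasoning
  ... | y , z , vy , vz , refl = ∄yz (lose (∈-cartesianProduct⁺ y∈ z∈) (y≢z , xyz∈))
    where
    xyz∈ = subst (_∈ A) m≡xw m∈A
    y∈ = ∈vars⁺ (downClosed xyz∈ (∣ᵐ-trans (u∣u·v y z) (v∣u·v x (y · z)))) vy
    z∈ = ∈vars⁺ (downClosed xyz∈ (∣ᵐ-trans (v∣u·v y z) (v∣u·v x (y · z)))) vz
    y≢z : y ≢ z
    y≢z refl = ¬nbr (y , y∈ , downClosed xyz∈ (v∣u·v x (y · y)) , x·y·z∈⇒x·y∈ xyz∈)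

  partner∈vars : ∀ {x} → x ∈ vars → (k : Kind x) (b : Bool) → partner x k b ∈ vars
  partner∈vars x∈ (loop _)                     _     = x∈
  partner∈vars x∈ (nextToLoop _ _ y∈ _ _)      _     = y∈
  partner∈vars x∈ (triangle _ _ _ _ y∈ _ _ _)  true  = y∈
  partner∈vars x∈ (triangle _ _ _ _ _ z∈ _ _)  false = z∈
  partner∈vars x∈ (stranded _ _ _)             _     = x∈

  x·partner∈quads : ∀ {x} → x ∈ vars → (k : Kind x) (b : Bool) → x · partner x k b ∈ quads
  x·partner∈quads {x} x∈ k b = ∈-ofDeg⁺ 2 (edge∈A k b)
    (deg-var·var x _ (∈vars⇒IsVar x∈) (∈vars⇒IsVar (partner∈vars x∈ k b)))
    where
    edge∈A : (k : Kind x) (b : Bool) → x · partner x k b ∈ A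
    edge∈A (loop lx)                         _     = lx
    edge∈A (nextToLoop _ _ _ _ xy∈)          _     = xy∈
    edge∈A (triangle _ _ y z _ _ _ xyz∈)     true  = x·y·z∈⇒x·y∈ xyz∈
    edge∈A (triangle _ _ y z _ _ _ xyz∈)     false = x·y·z∈⇒x·y∈ (subst (_∈ A) (·-swap₂₃ x y z) xyz∈)
    edge∈A (stranded _ ¬nbr ∄yz)             _     =
      contradiction ∄yz (¬HasLoopedNeighbour⇒¬¬InTriangle x∈ ¬nbr)

  Looped⇒partner≡self : ∀ {x} (k : Kind x) b → Looped x → partner x k b ≡ x
  Looped⇒partner≡self (loop _)                   _ _  = refl
  Looped⇒partner≡self (nextToLoop ¬lx _ _ _ _)   _ lx = contradiction lx ¬lx
  Looped⇒partner≡self (triangle ¬lx _ _ _ _ _ _ _) _ lx = contradiction lx ¬lx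
  Looped⇒partner≡self (stranded _ _ _)           _ _  = refl

  orientation-towards-¬Looped : ∀ {x} (k : Kind x) b → partner x k b ≢ x → ¬ Looped (partner x k b) →
                                orientation x k b ≡ precedes x (partner x k b)
  orientation-towards-¬Looped (loop _)                 _ p≢x _   = contradiction refl p≢x
  orientation-towards-¬Looped (nextToLoop _ _ _ ly _)  _ _   ¬lp = contradiction ly ¬lp
  orientation-towards-¬Looped (triangle _ _ _ _ _ _ _ _) _ _ _   = refl
  orientation-towards-¬Looped (stranded _ _ _)         _ p≢x _   = contradiction refl p≢x

  loopedNeighbour-partner : ∀ {x} (k : Kind x) → x ∈ vars → ¬ Looped x → HasLoopedNeighbour x →
                            ∃[ y ] Looped y × ∀ b → partner x k b ≡ y
  loopedNeighbour-partner (loop lx)                 _  ¬lx _   = contradiction lx ¬lx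
  loopedNeighbour-partner (nextToLoop _ y _ ly _)   _  _   _   = y , ly , λ _ → refl
  loopedNeighbour-partner (triangle _ ¬nbr _ _ _ _ _ _) _ _ nbr = contradiction nbr ¬nbr
  loopedNeighbour-partner (stranded _ ¬nbr _)       _  _   nbr = contradiction nbr ¬nbr

  partner-bit-injective : ∀ {x} (k : Kind x) {b b'} → x · partner x k b ≡ x · partner x k b' →
                          orientation x k b ≡ orientation x k b' → b ≡ b'
  partner-bit-injective (loop _)               _ o≡o' = o≡o'
  partner-bit-injective (nextToLoop _ _ _ _ _) _ o≡o' = o≡o'
  partner-bit-injective (stranded _ _ _)       _ o≡o' = o≡o'
  partner-bit-injective (triangle _ _ _ _ _ _ _ _) {true}  {true}  _ _ = refl
  partner-bit-injective (triangle _ _ _ _ _ _ _ _) {false} {false} _ _ = refl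
  partner-bit-injective {x} (triangle _ _ y z _ _ y≢z _) {true}  {false} xy≡xz _ =
    contradiction (·-cancelˡ x y z xy≡xz) y≢z
  partner-bit-injective {x} (triangle _ _ y z _ _ y≢z _) {false} {true}  xz≡xy _ =
    contradiction (sym (·-cancelˡ x z y xz≡xy)) y≢z

  -- Two tokens of distinct variables x, x' on the same edge xx' could only clash in the triangle
  -- case, and there the bits precedes x x' and precedes x' x differ.
  ψ-injective : ∀ {p p'} → p ∈ tokens vars → p' ∈ tokens vars → ψ p ≡ ψ p' → p ≡ p'
  ψ-injective {x , b} {x' , b'} p∈ p'∈ ψp≡ψp' with x ≟ᵐ x'
  ... | yes refl = cong (x ,_) (partner-bit-injective (kind x) (cong proj₁ ψp≡ψp') (cong proj₂ ψp≡ψp'))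
  ... | no  x≢x' = contradiction (trans (sym o≡) (trans (cong proj₂ ψp≡ψp') o'≡)) (precedes-antisym x x' x≢x')
    where
    x∈  = ∈-tokens⁻ vars p∈
    x'∈ = ∈-tokens⁻ vars p'∈
    crossed = var·var-crossed (∈vars⇒IsVar x∈) (∈vars⇒IsVar x'∈)
      (∈vars⇒IsVar (partner∈vars x∈ (kind x) b)) (∈vars⇒IsVar (partner∈vars x'∈ (kind x') b'))
      x≢x' (cong proj₁ ψp≡ψp')
    p≡x' = proj₂ crossed
    p'≡x = sym (proj₁ crossed)
    ¬lx : ¬ Looped x
    ¬lx lx = x≢x' (trans (sym (Looped⇒partner≡self (kind x) b lx)) p≡x')
    ¬lx' : ¬ Looped x'
    ¬lx' lx' = x≢x' (trans (sym p'≡x) (Looped⇒partner≡self (kind x') b' lx'))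
    o≡ : orientation x (kind x) b ≡ precedes x x'
    o≡ = trans (orientation-towards-¬Looped (kind x) b (λ p≡x → x≢x' (trans (sym p≡x) p≡x'))
                                            (subst (λ w → ¬ Looped w) (sym p≡x') ¬lx'))
               (cong (precedes x) p≡x')
    o'≡ : orientation x' (kind x') b' ≡ precedes x' x
    o'≡ = trans (orientation-towards-¬Looped (kind x') b' (λ p'≡x' → x≢x' (trans (sym p'≡x) p'≡x'))
                                             (subst (λ w → ¬ Looped w) (sym p'≡x) ¬lx))
                (cong (precedes x') p'≡x)

  -- ψ injects the 2 h₁ tokens of variables into the 2 h₂ = 2 h₁ pairs (edge, bit): it is onto.
  ψ-surjective : ∀ {q} c → q ∈ quads → ∃[ w ] ∃[ b ] w ∈ vars × ψ (w , b) ≡ (q , c)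
  ψ-surjective {q} c q∈ =
    let ((w , b) , wb∈ , qc≡) = ∈-map⁻ ψ (Unique-⊆-length≥⇒⊇ (≡-dec _≟ᵐ_ Bool._≟_)
          image-unique image⊆ tokens-quads≤image (∈-tokens⁺ c q∈))
    in w , b , ∈-tokens⁻ vars wb∈ , sym qc≡
    where
    image-unique : Unique (map ψ (tokens vars))
    image-unique = Unique-map⁺ ψ (Unique-tokens (Unique-ofDeg 1 unique)) ψ-injective
    image⊆ : map ψ (tokens vars) ⊆ tokens quads
    image⊆ t∈ with ∈-map⁻ ψ t∈
    ... | (w , b) , wb∈ , refl =
      ∈-tokens⁺ (orientation w (kind w) b) (x·partner∈quads (∈-tokens⁻ vars wb∈) (kind w) b)
    tokens-quads≤image : length (tokens quads) ≤ length (map ψ (tokens vars))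
    tokens-quads≤image = ≤-reflexive (begin
      length (tokens quads)        ≡⟨ length-tokens quads ⟩
      countDeg A 2 * 2             ≡⟨ cong (_* 2) h₁≡h₂ ⟨
      countDeg A 1 * 2             ≡⟨ length-tokens vars ⟨
      length (tokens vars)         ≡⟨ length-map ψ (tokens vars) ⟨
      length (map ψ (tokens vars)) ∎)
      where open ≡-Reasoning

  Sends : Monomial s → Bool → Monomial s → Bool → Set
  Sends x b y c = partner x (kind x) b ≡ y × orientation x (kind x) b ≡ c

  edge-token-sent : ∀ {x y} c → x ∈ vars → y ∈ vars → x · y ∈ A →
                    (∃[ b ] Sends x b y c) ⊎ (∃[ b ] Sends y b x c)
  edge-token-sent {x} {y} c x∈ y∈ xy∈
    with ψ-surjective c (∈-ofDeg⁺ 2 xy∈ (deg-var·var x y (∈vars⇒IsVar x∈) (∈vars⇒IsVar y∈)))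
  ... | w , b , w∈ , ψwb≡ with vars-·-injective (∈vars⇒IsVar w∈) (∈vars⇒IsVar (partner∈vars w∈ (kind w) b))
                                                (∈vars⇒IsVar x∈) (∈vars⇒IsVar y∈) (cong proj₁ ψwb≡)
  ... | inj₁ (refl , p≡y) = inj₁ (b , p≡y , cong proj₂ ψwb≡)
  ... | inj₂ (refl , p≡x) = inj₂ (b , p≡x , cong proj₂ ψwb≡)

  looped-adjacent⇒≡ : ∀ {x y} → x ∈ vars → y ∈ vars → Looped x → Looped y → x · y ∈ A → x ≡ y
  looped-adjacent⇒≡ x∈ y∈ lx ly xy∈ with edge-token-sent true x∈ y∈ xy∈
  ... | inj₁ (b , p≡y , _) = trans (sym (Looped⇒partner≡self (kind _) b lx)) p≡y
  ... | inj₂ (b , p≡x , _) = trans (sym p≡x) (Looped⇒partner≡self (kind _) b ly)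

  HasLoopedNeighbour⇒partner-Looped : ∀ {x y b} → x ∈ vars → ¬ Looped x → HasLoopedNeighbour x →
                                      partner x (kind x) b ≡ y → Looped y
  HasLoopedNeighbour⇒partner-Looped {b = b} x∈ ¬lx nbr p≡y =
    let (w , lw , p≡w) = loopedNeighbour-partner (kind _) x∈ ¬lx nbr in
    subst Looped (trans (sym (p≡w b)) p≡y) lw

  partner≡loopedNeighbour : ∀ {c d} → c ∈ vars → ¬ Looped c → d ∈ vars → Looped d → c · d ∈ A →
                            ∀ b → partner c (kind c) b ≡ d
  partner≡loopedNeighbour {c} c∈ ¬lc d∈ ld cd∈ b' with edge-token-sent true c∈ d∈ cd∈
  ... | inj₁ (b , p≡d , _) =
    let (_ , _ , p≡y) = loopedNeighbour-partner (kind c) c∈ ¬lc (_ , d∈ , ld , cd∈) in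
    trans (p≡y b') (trans (sym (p≡y b)) p≡d)
  ... | inj₂ (b , p≡c , _) =
    contradiction (subst Looped (trans (sym (Looped⇒partner≡self (kind _) b ld)) p≡c) ld) ¬lc

  record Triangle (x y z : Monomial s) : Set where
    field
      x∈  : x ∈ vars
      y∈  : y ∈ vars
      z∈  : z ∈ vars
      x≢y : x ≢ y
      y≢z : y ≢ z
      x≢z : x ≢ z
      xyz∈ : x · y · z ∈ A

    xy∈ : x · y ∈ A
    xy∈ = x·y·z∈⇒x·y∈ xyz∈

    xz∈ : x · z ∈ A
    xz∈ = x·y·z∈⇒x·y∈ (subst (_∈ A) (·-swap₂₃ x y z) xyz∈)

    yz∈ : y · z ∈ A
    yz∈ = downClosed xyz∈ (v∣u·v x (y · z))

  Triangle-swap₁₂ : ∀ {x y z} → Triangle x y z → Triangle y x z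
  Triangle-swap₁₂ {x} {y} {z} t = record
    { x∈ = y∈ ; y∈ = x∈ ; z∈ = z∈ ; x≢y = λ y≡x → x≢y (sym y≡x) ; y≢z = x≢z ; x≢z = y≢z
    ; xyz∈ = subst (_∈ A) (·-exchange x y z) xyz∈ }
    where open Triangle t

  Triangle-swap₂₃ : ∀ {x y z} → Triangle x y z → Triangle x z y
  Triangle-swap₂₃ {x} {y} {z} t = record
    { x∈ = x∈ ; y∈ = z∈ ; z∈ = y∈ ; x≢y = x≢z ; y≢z = λ z≡y → y≢z (sym z≡y) ; x≢z = x≢y
    ; xyz∈ = subst (_∈ A) (·-swap₂₃ x y z) xyz∈ }
    where open Triangle t

  triangle⇒¬Looped : ∀ {x y z} → Triangle x y z → ¬ Looped x
  triangle⇒¬Looped {x} {y} {z} t lx with edge-token-sent true y∈ z∈ yz∈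
    where open Triangle t
  ... | inj₁ (_ , p≡z , _) = ¬lz (HasLoopedNeighbour⇒partner-Looped (Triangle.y∈ t) ¬ly nbr-y p≡z)
    where
    open Triangle t
    ¬ly : ¬ Looped y
    ¬ly ly = x≢y (looped-adjacent⇒≡ x∈ y∈ lx ly xy∈)
    ¬lz : ¬ Looped z
    ¬lz lz = x≢z (looped-adjacent⇒≡ x∈ z∈ lx lz xz∈)
    nbr-y = x , x∈ , lx , subst (_∈ A) (·-comm x y) xy∈
  ... | inj₂ (_ , p≡y , _) = ¬ly (HasLoopedNeighbour⇒partner-Looped (Triangle.z∈ t) ¬lz nbr-z p≡y)
    where
    open Triangle t
    ¬ly : ¬ Looped y
    ¬ly ly = x≢y (looped-adjacent⇒≡ x∈ y∈ lx ly xy∈)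
    ¬lz : ¬ Looped z
    ¬lz lz = x≢z (looped-adjacent⇒≡ x∈ z∈ lx lz xz∈)
    nbr-z = x , x∈ , lx , subst (_∈ A) (·-comm x z) xz∈

  -- The token on xy with bit precedes x y is spent by x: were it y's, its bit would be precedes y x.
  triangle-token-sender : ∀ {x y z} → Triangle x y z → ∃[ b ] partner x (kind x) b ≡ y
  triangle-token-sender {x} {y} {z} t with edge-token-sent (precedes x y) x∈ y∈ xy∈
    where open Triangle t
  ... | inj₁ (b , p≡y , _) = b , p≡y
  ... | inj₂ (b , p≡x , o≡) = contradiction (trans (sym o≡) o≡precedes) (precedes-antisym x y x≢y)
    where
    open Triangle t
    o≡precedes : orientation y (kind y) b ≡ precedes y x
    o≡precedes = trans (orientation-towards-¬Looped (kind y) b (λ p≡y → x≢y (trans (sym p≡x) p≡y))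
                                                    (subst (λ w → ¬ Looped w) (sym p≡x) (triangle⇒¬Looped t)))
                       (cong (precedes y) p≡x)

  triangle⇒¬HasLoopedNeighbour : ∀ {x y z} → Triangle x y z → ¬ HasLoopedNeighbour x
  triangle⇒¬HasLoopedNeighbour t nbr =
    let (_ , p≡y) = triangle-token-sender t in
    triangle⇒¬Looped (Triangle-swap₁₂ t)
      (HasLoopedNeighbour⇒partner-Looped (Triangle.x∈ t) (triangle⇒¬Looped t) nbr p≡y)

  triangle≡x·partners : ∀ {x y z} → Triangle x y z →
                        x · y · z ≡ x · partner x (kind x) true · partner x (kind x) false
  triangle≡x·partners {x} t with triangle-token-sender t | triangle-token-sender (Triangle-swap₂₃ t)
  ... | true  , refl | false , refl = refl
  ... | false , refl | true  , refl = ·-swap₂₃ x _ _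
  ... | true  , p≡y  | true  , p≡z  = contradiction (trans (sym p≡y) p≡z) (Triangle.y≢z t)
  ... | false , p≡y  | false , p≡z  = contradiction (trans (sym p≡y) p≡z) (Triangle.y≢z t)

  cube⇒Looped : ∀ {m c} → m ∈ A → m ≡ c · c · c → Looped c
  cube⇒Looped m∈A refl = x·y·z∈⇒x·y∈ m∈A

  square⇒loopedNeighbour : ∀ {m c} d → m ∈ A → c ∈ vars → IsVar d → d ≢ c → m ≡ d · d · c →
                           d ∈ vars × Looped d × c · d ∈ A × ¬ Looped c
  square⇒loopedNeighbour {c = c} d m∈A c∈ vd d≢c refl = d∈ , ld , subst (_∈ A) (·-comm d c) dc∈ , ¬lc
    where
    dc∈ = downClosed m∈A (v∣u·v d (d · c))
    ld  = x·y·z∈⇒x·y∈ m∈A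
    d∈  = ∈vars⁺ (downClosed m∈A (u∣u·v d (d · c))) vd
    ¬lc : ¬ Looped c
    ¬lc lc = d≢c (looped-adjacent⇒≡ d∈ c∈ ld lc dc∈)

  distinct⇒Triangle : ∀ {m c} p q → m ∈ A → c ∈ vars → IsVar p → IsVar q →
                      c ≢ p → c ≢ q → p ≢ q → m ≡ c · p · q → Triangle c p q
  distinct⇒Triangle {c = c} p q m∈A c∈ vp vq c≢p c≢q p≢q refl = record
    { x∈ = c∈
    ; y∈ = ∈vars⁺ (downClosed m∈A (∣ᵐ-trans (u∣u·v p q) (v∣u·v c (p · q)))) vp
    ; z∈ = ∈vars⁺ (downClosed m∈A (∣ᵐ-trans (v∣u·v p q) (v∣u·v c (p · q)))) vq
    ; x≢y = c≢p ; y≢z = p≢q ; x≢z = c≢q ; xyz∈ = m∈A }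

  Shape-injective : ∀ {m m' c} → m ∈ A → m' ∈ A → c ∈ vars → Shape m c → Shape m' c → m ≡ m'
  Shape-injective _ _ _ (cube m≡) (cube m'≡) = trans m≡ (sym m'≡)
  Shape-injective m∈ m'∈ c∈ (cube m≡) (square d vd d≢c m'≡) =
    contradiction (cube⇒Looped m∈ m≡) (proj₂ (proj₂ (proj₂ (square⇒loopedNeighbour d m'∈ c∈ vd d≢c m'≡))))
  Shape-injective m∈ m'∈ c∈ (square d vd d≢c m≡) (cube m'≡) =
    contradiction (cube⇒Looped m'∈ m'≡) (proj₂ (proj₂ (proj₂ (square⇒loopedNeighbour d m∈ c∈ vd d≢c m≡))))
  Shape-injective m∈ m'∈ c∈ (cube m≡) (distinct p q vp vq c≢p c≢q p≢q m'≡) =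
    contradiction (cube⇒Looped m∈ m≡) (triangle⇒¬Looped (distinct⇒Triangle p q m'∈ c∈ vp vq c≢p c≢q p≢q m'≡))
  Shape-injective m∈ m'∈ c∈ (distinct p q vp vq c≢p c≢q p≢q m≡) (cube m'≡) =
    contradiction (cube⇒Looped m'∈ m'≡) (triangle⇒¬Looped (distinct⇒Triangle p q m∈ c∈ vp vq c≢p c≢q p≢q m≡))
  Shape-injective {c = c} m∈ m'∈ c∈ (square d vd d≢c m≡) (square d' vd' d'≢c m'≡)
    with square⇒loopedNeighbour d m∈ c∈ vd d≢c m≡ | square⇒loopedNeighbour d' m'∈ c∈ vd' d'≢c m'≡
  ... | d∈ , ld , cd∈ , ¬lc | d'∈ , ld' , cd'∈ , _ = begin
    _             ≡⟨ m≡ ⟩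
    d · d · c     ≡⟨ cong (λ w → w · w · c) d≡d' ⟩
    d' · d' · c   ≡⟨ m'≡ ⟨
    _             ∎
    where
    open ≡-Reasoning
    d≡d' = trans (sym (partner≡loopedNeighbour c∈ ¬lc d∈ ld cd∈ true))
                 (partner≡loopedNeighbour c∈ ¬lc d'∈ ld' cd'∈ true)
  Shape-injective m∈ m'∈ c∈ (square d vd d≢c m≡) (distinct p q vp vq c≢p c≢q p≢q m'≡) =
    let (d∈ , ld , cd∈ , _) = square⇒loopedNeighbour d m∈ c∈ vd d≢c m≡ in
    contradiction (d , d∈ , ld , cd∈)
      (triangle⇒¬HasLoopedNeighbour (distinct⇒Triangle p q m'∈ c∈ vp vq c≢p c≢q p≢q m'≡))
  Shape-injective m∈ m'∈ c∈ (distinct p q vp vq c≢p c≢q p≢q m≡) (square d vd d≢c m'≡) =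
    let (d∈ , ld , cd∈ , _) = square⇒loopedNeighbour d m'∈ c∈ vd d≢c m'≡ in
    contradiction (d , d∈ , ld , cd∈)
      (triangle⇒¬HasLoopedNeighbour (distinct⇒Triangle p q m∈ c∈ vp vq c≢p c≢q p≢q m≡))
  Shape-injective m∈ m'∈ c∈ (distinct p q vp vq c≢p c≢q p≢q m≡) (distinct p' q' vp' vq' c≢p' c≢q' p'≢q' m'≡) =
    trans (trans m≡ (triangle≡x·partners (distinct⇒Triangle p q m∈ c∈ vp vq c≢p c≢q p≢q m≡)))
          (sym (trans m'≡ (triangle≡x·partners (distinct⇒Triangle p' q' m'∈ c∈ vp' vq' c≢p' c≢q' p'≢q' m'≡))))

  centre∈vars : ∀ {m} → m ∈ cubics → centre m ∈ vars
  centre∈vars {m} m∈ =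
    let (m∈A , dm) = ∈-ofDeg⁻ {A = A} 3 m∈
        (sh , vc)  = Shape-centre m dm
    in ∈vars⁺ (downClosed m∈A (Shape⇒∣ sh)) vc

  centre-injective : ∀ {m m'} → m ∈ cubics → m' ∈ cubics → centre m ≡ centre m' → m ≡ m'
  centre-injective {m} {m'} m∈ m'∈ c≡c' =
    let (m∈A , dm)   = ∈-ofDeg⁻ {A = A} 3 m∈
        (m'∈A , dm') = ∈-ofDeg⁻ {A = A} 3 m'∈
    in Shape-injective m∈A m'∈A (centre∈vars m∈) (proj₁ (Shape-centre m dm))
         (subst (Shape m') (sym c≡c') (proj₁ (Shape-centre m' dm')))

  countDeg3≤countDeg1 : countDeg A 3 ≤ countDeg A 1
  countDeg3≤countDeg1 = begin
    countDeg A 3               ≡⟨ length-map centre cubics ⟨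
    length (map centre cubics) ≤⟨ Unique-⊆⇒length≤ centres-unique centres⊆vars ⟩
    countDeg A 1               ∎
    where
    open ≤-Reasoning
    centres-unique = Unique-map⁺ centre (Unique-ofDeg 3 unique) centre-injective
    centres⊆vars : map centre cubics ⊆ vars
    centres⊆vars c∈ = let (m , m∈ , c≡) = ∈-map⁻ centre c∈ in subst (_∈ vars) (sym c≡) (centre∈vars m∈)

divisors : Monomial s → List (Monomial s)
divisors []      = [] ∷ []
divisors (e ∷ u) = concatMap (λ k → map (k ∷_) (divisors u)) (upTo (suc e))

∈-divisors⁺ : {v u : Monomial s} → v ∣ᵐ u → v ∈ divisors u
∈-divisors⁺ [] = here refl
∈-divisors⁺ {v = k ∷ v} {e ∷ u} (k≤e ∷ v∣u) =
  ∈-concatMap⁺ (λ k → map (k ∷_) (divisors u)) (lose (∈-upTo⁺ (s≤s k≤e)) (∈-map⁺ (k ∷_) (∈-divisors⁺ v∣u)))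

∈-divisors⁻ : {v u : Monomial s} → v ∈ divisors u → v ∣ᵐ u
∈-divisors⁻ {v = []}    {[]}    _  = []
∈-divisors⁻ {v = k ∷ v} {e ∷ u} v∈
  with find (∈-concatMap⁻ (λ k → map (k ∷_) (divisors u)) {xs = upTo (suc e)} v∈)
... | j , j∈ , kv∈ with ∈-map⁻ (j ∷_) kv∈
... | w , w∈ , refl = ≤-pred (∈-upTo⁻ j∈) ∷ ∈-divisors⁻ w∈

module Generated (G : List (Monomial s)) where

  ideal : List (Monomial s)
  ideal = deduplicate _≟ᵐ_ (concatMap divisors G)

  ∈-ideal⁺ : ∀ {v g} → g ∈ G → v ∣ᵐ g → v ∈ ideal
  ∈-ideal⁺ g∈G v∣g = ∈-deduplicate⁺ _≟ᵐ_ (∈-concatMap⁺ divisors (lose g∈G (∈-divisors⁺ v∣g)))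

  ∈-ideal⁻ : ∀ {v} → v ∈ ideal → ∃[ g ] g ∈ G × v ∣ᵐ g
  ∈-ideal⁻ v∈ =
    let (g , g∈G , v∈divs) = find (∈-concatMap⁻ divisors {xs = G} (∈-deduplicate⁻ _≟ᵐ_ (concatMap divisors G) v∈))
    in g , g∈G , ∈-divisors⁻ v∈divs

  isOrderIdeal : G ≢ [] → IsOrderIdeal ideal
  isOrderIdeal G≢[] = record
    { unique     = UniqueDec.deduplicate-! _≟ᵐ_ (concatMap divisors G)
    ; nonempty   = λ ideal≡[] → ¬Any[] (subst (1ᵐ ∈_) ideal≡[] 1ᵐ∈)
    ; downClosed = λ u∈ v∣u → let (g , g∈G , u∣g) = ∈-ideal⁻ u∈ in ∈-ideal⁺ g∈G (∣ᵐ-trans v∣u u∣g)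
    }
    where
    1ᵐ∈ : 1ᵐ ∈ ideal
    1ᵐ∈ = let (g , g∈G) = ≢[]⇒∃∈ G≢[] in ∈-ideal⁺ g∈G (1ᵐ∣u g)

  module _ {n : ℕ} (G-deg : All (λ g → deg g ≡ n) G) where

    maximal⇒deg≡ : ∀ {u} → IsMaximal ideal u → deg u ≡ n
    maximal⇒deg≡ (u∈ , u-max) =
      let (g , g∈G , u∣g) = ∈-ideal⁻ u∈ in
      trans (cong deg (sym (u-max (∈-ideal⁺ g∈G (∣ᵐ-refl g)) u∣g))) (All.lookup G-deg g∈G)

    isPure : IsPure ideal
    isPure u-max v-max = trans (maximal⇒deg≡ u-max) (sym (maximal⇒deg≡ v-max))

hVector-shape : {A : List (Monomial s)} {n : ℕ} → maxDeg A ≡ n →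
                hVector A ≡ countDeg A 0 ∷ map (countDeg A ∘ suc) (upTo n)
hVector-shape {A = A} {n} refl = cong (countDeg A 0 ∷_) (begin
  map (countDeg A) (List.applyUpTo suc n) ≡⟨ cong (map (countDeg A)) (List.map-upTo suc n) ⟨
  map (countDeg A) (map suc (upTo n))     ≡⟨ List.map-∘ {g = countDeg A} {f = suc} (upTo n) ⟨
  map (countDeg A ∘ suc) (upTo n)         ∎)
  where open ≡-Reasoning

hVector≡1∷⇒ : {A : List (Monomial s)} {h : List ℕ} → hVector A ≡ 1 ∷ h →
              maxDeg A ≡ length h × map (countDeg A ∘ suc) (upTo (length h)) ≡ h
hVector≡1∷⇒ {A = A} {h} hv≡ = maxDeg≡ , List.∷-injectiveʳ (trans (sym (hVector-shape {A = A} maxDeg≡)) hv≡)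
  where
  maxDeg≡ : maxDeg A ≡ length h
  maxDeg≡ = suc-injective (begin
    suc (maxDeg A)                               ≡⟨ List.length-upTo (suc (maxDeg A)) ⟨
    length (upTo (suc (maxDeg A)))               ≡⟨ length-map (countDeg A) (upTo (suc (maxDeg A))) ⟨
    length (hVector A)                           ≡⟨ cong length hv≡ ⟩
    suc (length h)                               ∎)
    where open ≡-Reasoning

-- Necessity of the bounds

≤2*⇒⌈/2⌉≤ : ∀ {a b} → a ≤ 2 * b → ⌈ a /2⌉ ≤ b
≤2*⇒⌈/2⌉≤ {a} {b} a≤2b =
  subst (⌈ a /2⌉ ≤_) (sym (n≡⌈n+n/2⌉ b)) (⌈n/2⌉-mono (subst (a ≤_) (cong (b +_) (+-identityʳ b)) a≤2b))

≤3*⇒⌈/3⌉≤ : ∀ {a b} → a ≤ 3 * b → ⌈ a /3⌉ ≤ b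
≤3*⇒⌈/3⌉≤ {a} {b} a≤3b = ≤-pred (m<n*o⇒m/o<n {a + 2} {suc b} {3} (begin-strict
  a + 2       ≤⟨ +-monoˡ-≤ 2 a≤3b ⟩
  3 * b + 2   <⟨ +-monoʳ-< (3 * b) (n<1+n 2) ⟩
  3 * b + 3   ≡⟨ +-comm (3 * b) 3 ⟩
  3 + 3 * b   ≡⟨ *-suc 3 b ⟨
  3 * suc b   ≡⟨ *-comm 3 (suc b) ⟩
  suc b * 3   ∎))
  where open ≤-Reasoning

⌈/3⌉≤⇒≤3* : ∀ {a b} → ⌈ a /3⌉ ≤ b → a ≤ 3 * b
⌈/3⌉≤⇒≤3* {a} {b} ⌈a/3⌉≤b = +-cancelʳ-≤ 2 a (3 * b) (begin
  a + 2                         ≡⟨ m≡m%n+[m/n]*n (a + 2) 3 ⟩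
  (a + 2) % 3 + (a + 2) / 3 * 3 ≤⟨ +-mono-≤ (≤-pred (m%n<n (a + 2) 3)) (*-monoˡ-≤ 3 ⌈a/3⌉≤b) ⟩
  2 + b * 3                     ≡⟨ +-comm 2 (b * 3) ⟩
  b * 3 + 2                     ≡⟨ cong (_+ 2) (*-comm b 3) ⟩
  3 * b + 2                     ∎)
  where open ≤-Reasoning

IsPureOSequence[1,a,b]⇒bounds : ∀ {a b} → IsPureOSequence (1 ∷ a ∷ b ∷ []) →
                                ⌈ a /2⌉ ≤ b × b ≤ (a + 1) C 2
IsPureOSequence[1,a,b]⇒bounds (_ , _ , A , ideal , pure , hv≡) with hVector≡1∷⇒ {A = A} hv≡
... | maxDeg≡2 , refl = lower , upper
  where
  lower : ⌈ countDeg A 1 /2⌉ ≤ countDeg A 2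
  lower = ≤2*⇒⌈/2⌉≤ (subst (λ n → countDeg A 1 ≤ n * countDeg A n) maxDeg≡2
                           (countDeg1≤maxDeg*countTop ideal pure))
  upper : countDeg A 2 ≤ (countDeg A 1 + 1) C 2
  upper = subst (λ n → countDeg A 2 ≤ n C 2) (+-comm 1 (countDeg A 1)) (countDeg2≤choose ideal)

IsPureOSequence[1,a,a,b]⇒bounds : ∀ {a b} → IsPureOSequence (1 ∷ a ∷ a ∷ b ∷ []) → ⌈ a /3⌉ ≤ b × b ≤ a
IsPureOSequence[1,a,a,b]⇒bounds {a} {b} (_ , _ , A , ideal , pure , hv≡) = lower , upper
  where
  maxDeg≡3 = proj₁ (hVector≡1∷⇒ {A = A} hv≡)
  counts   = proj₂ (hVector≡1∷⇒ {A = A} hv≡)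
  h₁≡a = List.∷-injectiveˡ counts
  h₂≡a = List.∷-injectiveˡ (List.∷-injectiveʳ counts)
  h₃≡b = List.∷-injectiveˡ (List.∷-injectiveʳ (List.∷-injectiveʳ counts))
  lower : ⌈ a /3⌉ ≤ b
  lower = ≤3*⇒⌈/3⌉≤ (subst₂ _≤_ h₁≡a (cong (3 *_) h₃≡b)
    (subst (λ n → countDeg A 1 ≤ n * countDeg A n) maxDeg≡3 (countDeg1≤maxDeg*countTop ideal pure)))
  upper : b ≤ a
  upper = subst₂ _≤_ h₃≡b h₁≡a
    (CubicBound.countDeg3≤countDeg1 ideal pure maxDeg≡3 (trans h₁≡a (sym h₂≡a)))

-- Disjoint unions: the sum of pure O-sequences of the same length

countDeg-∷-≡ : (u : Monomial s) (A : List (Monomial s)) {i : ℕ} → deg u ≡ i →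
               countDeg (u ∷ A) i ≡ suc (countDeg A i)
countDeg-∷-≡ u A {i} du≡i = cong length (List.filter-accept (λ v → deg v ≟ i) {u} {A} du≡i)

countDeg-∷-≢ : (u : Monomial s) (A : List (Monomial s)) {i : ℕ} → deg u ≢ i →
               countDeg (u ∷ A) i ≡ countDeg A i
countDeg-∷-≢ u A {i} du≢i = cong length (List.filter-reject (λ v → deg v ≟ i) {u} {A} du≢i)

countDeg-map : (f : Monomial s → Monomial t) → (∀ u → deg (f u) ≡ deg u) →
               (A : List (Monomial s)) (i : ℕ) → countDeg (map f A) i ≡ countDeg A i
countDeg-map f deg-f []      i = refl
countDeg-map f deg-f (u ∷ A) i with deg u ≟ i
... | yes du≡i = begin
  countDeg (f u ∷ map f A) i ≡⟨ countDeg-∷-≡ (f u) (map f A) (trans (deg-f u) du≡i) ⟩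
  suc (countDeg (map f A) i) ≡⟨ cong suc (countDeg-map f deg-f A i) ⟩
  suc (countDeg A i)         ≡⟨ countDeg-∷-≡ u A du≡i ⟨
  countDeg (u ∷ A) i         ∎
  where open ≡-Reasoning
... | no du≢i = begin
  countDeg (f u ∷ map f A) i ≡⟨ countDeg-∷-≢ (f u) (map f A) (du≢i ∘ trans (sym (deg-f u))) ⟩
  countDeg (map f A) i       ≡⟨ countDeg-map f deg-f A i ⟩
  countDeg A i               ≡⟨ countDeg-∷-≢ u A du≢i ⟨
  countDeg (u ∷ A) i         ∎
  where open ≡-Reasoning

nonconstant : List (Monomial s) → List (Monomial s)
nonconstant = filter (λ v → ¬? (deg v ≟ 0))

countDeg-nonconstant : (A : List (Monomial s)) (i : ℕ) → countDeg (nonconstant A) (suc i) ≡ countDeg A (suc i)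
countDeg-nonconstant []      i = refl
countDeg-nonconstant (v ∷ A) i with deg v ≟ 0 | deg v ≟ suc i
... | yes dv≡0 | _ = begin
  countDeg (nonconstant (v ∷ A)) (suc i) ≡⟨ cong (λ B → countDeg B (suc i)) dropped ⟩
  countDeg (nonconstant A) (suc i)       ≡⟨ countDeg-nonconstant A i ⟩
  countDeg A (suc i)                     ≡⟨ countDeg-∷-≢ v A (λ dv≡ → 0≢1+n (trans (sym dv≡0) dv≡)) ⟨
  countDeg (v ∷ A) (suc i)               ∎
  where
  open ≡-Reasoning
  dropped = List.filter-reject (λ v → ¬? (deg v ≟ 0)) {v} {A} (λ dv≢0 → dv≢0 dv≡0)
... | no dv≢0 | yes dv≡ = begin
  countDeg (nonconstant (v ∷ A)) (suc i)   ≡⟨ cong (λ B → countDeg B (suc i)) kept ⟩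
  countDeg (v ∷ nonconstant A) (suc i)     ≡⟨ countDeg-∷-≡ v (nonconstant A) dv≡ ⟩
  suc (countDeg (nonconstant A) (suc i))   ≡⟨ cong suc (countDeg-nonconstant A i) ⟩
  suc (countDeg A (suc i))                 ≡⟨ countDeg-∷-≡ v A dv≡ ⟨
  countDeg (v ∷ A) (suc i)                 ∎
  where
  open ≡-Reasoning
  kept = List.filter-accept (λ v → ¬? (deg v ≟ 0)) {v} {A} dv≢0
... | no dv≢0 | no dv≢ = begin
  countDeg (nonconstant (v ∷ A)) (suc i)   ≡⟨ cong (λ B → countDeg B (suc i)) kept ⟩
  countDeg (v ∷ nonconstant A) (suc i)     ≡⟨ countDeg-∷-≢ v (nonconstant A) dv≢ ⟩
  countDeg (nonconstant A) (suc i)         ≡⟨ countDeg-nonconstant A i ⟩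
  countDeg A (suc i)                       ≡⟨ countDeg-∷-≢ v A dv≢ ⟨
  countDeg (v ∷ A) (suc i)                 ∎
  where
  open ≡-Reasoning
  kept = List.filter-accept (λ v → ¬? (deg v ≟ 0)) {v} {A} dv≢0

deg-++ : ∀ {t} (u : Monomial s) (v : Monomial t) → deg (u ++ᵛ v) ≡ deg u + deg v
deg-++ []      v = refl
deg-++ (e ∷ u) v = trans (cong (e +_) (deg-++ u v)) (sym (+-assoc e (deg u) (deg v)))

∣ᵐ-++⁻ : ∀ {t} (u : Monomial s) (v : Monomial t) {w} → w ∣ᵐ (u ++ᵛ v) →
         ∃[ w₁ ] ∃[ w₂ ] w ≡ w₁ ++ᵛ w₂ × w₁ ∣ᵐ u × w₂ ∣ᵐ v
∣ᵐ-++⁻ []      v {w}     w∣v              = [] , w , refl , [] , w∣v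
∣ᵐ-++⁻ (e ∷ u) v {k ∷ w} (k≤e ∷ w∣uv) with ∣ᵐ-++⁻ u v w∣uv
... | w₁ , w₂ , refl , w₁∣u , w₂∣v = k ∷ w₁ , w₂ , refl , k≤e ∷ w₁∣u , w₂∣v

-- The first s variables carry A and the last t carry B; 1ᵐ is kept from A only.
module Union {s t : ℕ} {A : List (Monomial s)} {B : List (Monomial t)}
             (idealA : IsOrderIdeal A) (idealB : IsOrderIdeal B) where

  private
    module A = IsOrderIdeal idealA
    module B = IsOrderIdeal idealB

  inl : Monomial s → Monomial (s + t)
  inl u = u ++ᵛ 1ᵐ

  inr : Monomial t → Monomial (s + t)
  inr v = 1ᵐ ++ᵛ v

  deg-inl : ∀ u → deg (inl u) ≡ deg u
  deg-inl u = trans (deg-++ u 1ᵐ) (trans (cong (deg u +_) (deg-1ᵐ t)) (+-identityʳ (deg u)))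

  deg-inr : ∀ v → deg (inr v) ≡ deg v
  deg-inr v = trans (deg-++ (1ᵐ {s}) v) (cong (_+ deg v) (deg-1ᵐ s))

  union : List (Monomial (s + t))
  union = map inl A ++ map inr (nonconstant B)

  ∈-union⁻ : ∀ {w} → w ∈ union → (∃[ u ] u ∈ A × w ≡ inl u) ⊎ (∃[ v ] v ∈ nonconstant B × w ≡ inr v)
  ∈-union⁻ w∈ with ∈-++⁻ (map inl A) w∈
  ... | inj₁ w∈inl = inj₁ (∈-map⁻ inl w∈inl)
  ... | inj₂ w∈inr = inj₂ (∈-map⁻ inr w∈inr)

  inl∈union : ∀ {u} → u ∈ A → inl u ∈ union
  inl∈union u∈ = ∈-++⁺ˡ (∈-map⁺ inl u∈)

  inr∈union : ∀ {v} → v ∈ B → deg v ≢ 0 → inr v ∈ union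
  inr∈union v∈ dv≢0 = ∈-++⁺ʳ (map inl A) (∈-map⁺ inr (∈-filter⁺ (λ v → ¬? (deg v ≟ 0)) v∈ dv≢0))

  ∈nonconstant⁻ : ∀ {v} → v ∈ nonconstant B → v ∈ B × deg v ≢ 0
  ∈nonconstant⁻ = ∈-filter⁻ (λ v → ¬? (deg v ≟ 0))

  inl-injective : ∀ {u u'} → inl u ≡ inl u' → u ≡ u'
  inl-injective = Vecₚ.++-injectiveˡ _ _

  inr-injective : ∀ {v v'} → inr v ≡ inr v' → v ≡ v'
  inr-injective = Vecₚ.++-injectiveʳ (1ᵐ {s}) 1ᵐ

  isOrderIdeal : IsOrderIdeal union
  isOrderIdeal = record
    { unique     = Unique.++⁺ (Unique-map⁺ inl A.unique λ _ _ → inl-injective)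
                              (Unique-map⁺ inr (Unique.filter⁺ (λ v → ¬? (deg v ≟ 0)) B.unique) λ _ _ → inr-injective)
                              disjoint
    ; nonempty   = λ union≡[] → ¬Any[] (subst (inl 1ᵐ ∈_) union≡[] (inl∈union (1ᵐ∈ideal idealA)))
    ; downClosed = downClosed
    }
    where
    disjoint : ∀ {w} → ¬ (w ∈ map inl A × w ∈ map inr (nonconstant B))
    disjoint (w∈inl , w∈inr) with ∈-map⁻ inl w∈inl | ∈-map⁻ inr w∈inr
    ... | u , _ , refl | v , v∈ , inl-u≡inr-v =
      proj₂ (∈nonconstant⁻ v∈) (trans (cong deg (sym (Vecₚ.++-injectiveʳ u 1ᵐ inl-u≡inr-v))) (deg-1ᵐ t))
    downClosed : ∀ {w w'} → w ∈ union → w' ∣ᵐ w → w' ∈ union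
    downClosed w∈ w'∣w with ∈-union⁻ w∈
    ... | inj₁ (u , u∈ , refl) with ∣ᵐ-++⁻ u 1ᵐ w'∣w
    ...   | w₁ , w₂ , refl , w₁∣u , w₂∣1 rewrite ∣ᵐ1ᵐ⇒≡1ᵐ w₂∣1 = inl∈union (A.downClosed u∈ w₁∣u)
    downClosed w∈ w'∣w | inj₂ (v , v∈ , refl) with ∣ᵐ-++⁻ (1ᵐ {s}) v w'∣w
    ...   | w₁ , w₂ , refl , w₁∣1 , w₂∣v rewrite ∣ᵐ1ᵐ⇒≡1ᵐ w₁∣1 with deg w₂ ≟ 0
    ...     | yes dw₂≡0 = subst (_∈ union) (cong (1ᵐ ++ᵛ_) (sym (deg≡0⇒≡1ᵐ w₂ dw₂≡0)))
                                 (inl∈union (1ᵐ∈ideal idealA))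
    ...     | no  dw₂≢0 = inr∈union (B.downClosed (proj₁ (∈nonconstant⁻ v∈)) w₂∣v) dw₂≢0

  maximal⇒deg≡ : ∀ {n} → (∀ {u} → IsMaximal A u → deg u ≡ n) → (∀ {v} → IsMaximal B v → deg v ≡ n) →
                 ∀ {w} → IsMaximal union w → deg w ≡ n
  maximal⇒deg≡ maxA maxB (w∈ , w-max) with ∈-union⁻ w∈
  ... | inj₁ (u , u∈ , refl) = trans (deg-inl u) (maxA (u∈ , u-max))
    where
    u-max : ∀ {u'} → u' ∈ A → u ∣ᵐ u' → u' ≡ u
    u-max u'∈ u∣u' = inl-injective (w-max (inl∈union u'∈) (Pointwise.++⁺ u∣u' (∣ᵐ-refl 1ᵐ)))
  ... | inj₂ (v , v∈ , refl) = trans (deg-inr v) (maxB (proj₁ (∈nonconstant⁻ v∈) , v-max))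
    where
    v-max : ∀ {v'} → v' ∈ B → v ∣ᵐ v' → v' ≡ v
    v-max {v'} v'∈ v∣v' = inr-injective (w-max (inr∈union v'∈ dv'≢0) (Pointwise.++⁺ (∣ᵐ-refl (1ᵐ {s})) v∣v'))
      where
      dv'≢0 : deg v' ≢ 0
      dv'≢0 dv'≡0 = proj₂ (∈nonconstant⁻ v∈) (n≤0⇒n≡0 (subst (deg v ≤_) dv'≡0 (∣ᵐ⇒deg≤ v∣v')))

  countDeg-union : ∀ i → countDeg union (suc i) ≡ countDeg A (suc i) + countDeg B (suc i)
  countDeg-union i = begin
    countDeg union (suc i)
      ≡⟨ cong length (List.filter-++ (λ w → deg w ≟ suc i) (map inl A) (map inr (nonconstant B))) ⟩
    length (ofDeg (map inl A) (suc i) ++ ofDeg (map inr (nonconstant B)) (suc i))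
      ≡⟨ length-++ (ofDeg (map inl A) (suc i)) ⟩
    countDeg (map inl A) (suc i) + countDeg (map inr (nonconstant B)) (suc i)
      ≡⟨ cong₂ _+_ (countDeg-map inl deg-inl A (suc i)) (countDeg-map inr deg-inr (nonconstant B) (suc i)) ⟩
    countDeg A (suc i) + countDeg (nonconstant B) (suc i)
      ≡⟨ cong (countDeg A (suc i) +_) (countDeg-nonconstant B i) ⟩
    countDeg A (suc i) + countDeg B (suc i) ∎
    where open ≡-Reasoning

zipWith-+-map : ∀ {X : Set} (f g : X → ℕ) xs → zipWith _+_ (map f xs) (map g xs) ≡ map (λ x → f x + g x) xs
zipWith-+-map f g []       = refl
zipWith-+-map f g (x ∷ xs) = cong (f x + g x ∷_) (zipWith-+-map f g xs)

All-positive-zipWith-+ : ∀ {xs ys} → All (0 <_) xs → All (0 <_) ys → All (0 <_) (zipWith _+_ xs ys)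
All-positive-zipWith-+ []                _                 = []
All-positive-zipWith-+ (_ ∷ _)           []                = []
All-positive-zipWith-+ {x ∷ _} (0<x ∷ pos) (_ ∷ pos′) = ≤-trans 0<x (m≤m+n x _) ∷ All-positive-zipWith-+ pos pos′

IsPureOSequence-+ : ∀ {f g : List ℕ} → length f ≡ length g →
                    IsPureOSequence (1 ∷ f) → IsPureOSequence (1 ∷ g) → IsPureOSequence (1 ∷ zipWith _+_ f g)
IsPureOSequence-+ {f} {g} |f|≡|g| (_ ∷ pos-f , _ , A , idealA , pureA , hvA) (_ ∷ pos-g , _ , B , idealB , pureB , hvB) =
  s≤s z≤n ∷ All-positive-zipWith-+ pos-f pos-g , _ , union , isOrderIdeal , pure , hVector-union
  where
  open Union idealA idealB
  n = length f
  maxDegA≡n = proj₁ (hVector≡1∷⇒ {A = A} hvA)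
  maxDegB≡n = trans (proj₁ (hVector≡1∷⇒ {A = B} hvB)) (sym |f|≡|g|)
  maximal⇒deg≡n : ∀ {w} → IsMaximal union w → deg w ≡ n
  maximal⇒deg≡n = maximal⇒deg≡ (λ u-max → trans (maximal⇒deg≡maxDeg idealA pureA u-max) maxDegA≡n)
                               (λ v-max → trans (maximal⇒deg≡maxDeg idealB pureB v-max) maxDegB≡n)
  pure : IsPure union
  pure u-max v-max = trans (maximal⇒deg≡n u-max) (sym (maximal⇒deg≡n v-max))
  countsA : map (countDeg A ∘ suc) (upTo n) ≡ f
  countsA = proj₂ (hVector≡1∷⇒ {A = A} hvA)
  countsB : map (countDeg B ∘ suc) (upTo n) ≡ g
  countsB = trans (cong (λ k → map (countDeg B ∘ suc) (upTo k)) |f|≡|g|) (proj₂ (hVector≡1∷⇒ {A = B} hvB))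
  hVector-union : hVector union ≡ 1 ∷ zipWith _+_ f g
  hVector-union = begin
    hVector union
      ≡⟨ hVector-shape {A = union} (maximal-degrees⇒maxDeg≡ (IsOrderIdeal.nonempty isOrderIdeal) maximal⇒deg≡n) ⟩
    countDeg union 0 ∷ map (countDeg union ∘ suc) (upTo n)
      ≡⟨ cong₂ _∷_ (countDeg0≡1 isOrderIdeal) (List.map-cong countDeg-union (upTo n)) ⟩
    1 ∷ map (λ i → countDeg A (suc i) + countDeg B (suc i)) (upTo n)
      ≡⟨ cong (1 ∷_) (zipWith-+-map (countDeg A ∘ suc) (countDeg B ∘ suc) (upTo n)) ⟨
    1 ∷ zipWith _+_ (map (countDeg A ∘ suc) (upTo n)) (map (countDeg B ∘ suc) (upTo n))
      ≡⟨ cong (1 ∷_) (cong₂ (zipWith _+_) countsA countsB) ⟩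
    1 ∷ zipWith _+_ f g ∎
    where open ≡-Reasoning

-- Sufficiency for (1, a, a, b)

IsPureOSequence-principal : (g : Monomial s) → let A = Generated.ideal (g ∷ []) in
                            All (0 <_) (hVector A) → IsPureOSequence (hVector A)
IsPureOSequence-principal g pos = pos , _ , ideal , isOrderIdeal (λ ()) , isPure (refl ∷ []) , refl
  where open Generated (g ∷ [])

[1,1,1,1] : IsPureOSequence (1 ∷ 1 ∷ 1 ∷ 1 ∷ [])
[1,1,1,1] = IsPureOSequence-principal (3 ∷ []) (s≤s z≤n ∷ s≤s z≤n ∷ s≤s z≤n ∷ s≤s z≤n ∷ [])

[1,2,2,1] : IsPureOSequence (1 ∷ 2 ∷ 2 ∷ 1 ∷ [])
[1,2,2,1] = IsPureOSequence-principal (2 ∷ 1 ∷ []) (s≤s z≤n ∷ s≤s z≤n ∷ s≤s z≤n ∷ s≤s z≤n ∷ [])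

[1,3,3,1] : IsPureOSequence (1 ∷ 3 ∷ 3 ∷ 1 ∷ [])
[1,3,3,1] = IsPureOSequence-principal (1 ∷ 1 ∷ 1 ∷ []) (s≤s z≤n ∷ s≤s z≤n ∷ s≤s z≤n ∷ s≤s z≤n ∷ [])

-- A sum of b + 1 blocks; each x²y block adds 1 and each xyz block adds 2 to the excess k.
IsPureOSequence[1,b+k,b+k,b] : ∀ b k → k ≤ 2 * suc b →
                               IsPureOSequence (1 ∷ suc b + k ∷ suc b + k ∷ suc b ∷ [])
IsPureOSequence[1,b+k,b+k,b] zero zero                _ = [1,1,1,1]
IsPureOSequence[1,b+k,b+k,b] zero (suc zero)          _ = [1,2,2,1]
IsPureOSequence[1,b+k,b+k,b] zero (suc (suc zero))    _ = [1,3,3,1]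
IsPureOSequence[1,b+k,b+k,b] zero (suc (suc (suc k))) (s≤s (s≤s ()))
IsPureOSequence[1,b+k,b+k,b] (suc b) zero _ =
  IsPureOSequence-+ refl [1,1,1,1] (IsPureOSequence[1,b+k,b+k,b] b 0 z≤n)
IsPureOSequence[1,b+k,b+k,b] (suc b) (suc zero) _ =
  subst (λ x → IsPureOSequence (1 ∷ x ∷ x ∷ suc (suc b) ∷ [])) (cong (suc ∘ suc) (sym (+-suc b 0)))
        (IsPureOSequence-+ refl [1,2,2,1] (IsPureOSequence[1,b+k,b+k,b] b 0 z≤n))
IsPureOSequence[1,b+k,b+k,b] (suc b) (suc (suc k)) k+2≤ =
  subst (λ x → IsPureOSequence (1 ∷ x ∷ x ∷ suc (suc b) ∷ [])) (cong (suc ∘ suc) b+k+2≡)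
        (IsPureOSequence-+ refl [1,3,3,1] (IsPureOSequence[1,b+k,b+k,b] b k k≤))
  where
  b+k+2≡ : suc (suc (b + k)) ≡ b + suc (suc k)
  b+k+2≡ = sym (trans (+-suc b (suc k)) (cong suc (+-suc b k)))
  k≤ : k ≤ 2 * suc b
  k≤ = ≤-pred (≤-pred (subst (suc (suc k) ≤_) (*-suc 2 (suc b)) k+2≤))

bounds⇒IsPureOSequence[1,a,a,b] : ∀ {a b} → 0 < b → ⌈ a /3⌉ ≤ b → b ≤ a →
                                  IsPureOSequence (1 ∷ a ∷ a ∷ b ∷ [])
bounds⇒IsPureOSequence[1,a,a,b] {a} {suc b} _ ⌈a/3⌉≤b b≤a =
  subst (λ x → IsPureOSequence (1 ∷ x ∷ x ∷ suc b ∷ [])) (m+[n∸m]≡n b≤a)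
        (IsPureOSequence[1,b+k,b+k,b] b (a ∸ suc b) a-b≤2b)
  where
  a-b≤2b : a ∸ suc b ≤ 2 * suc b
  a-b≤2b = subst (a ∸ suc b ≤_) (m+n∸m≡n (suc b) (2 * suc b)) (∸-monoˡ-≤ (suc b) (⌈/3⌉≤⇒≤3* {a} ⌈a/3⌉≤b))

-- Sufficiency for (1, a, b)

allVars : ∀ s → List (Monomial s)
allVars s = varFactors (replicate s 1)

length-allVars : ∀ s → length (allVars s) ≡ s
length-allVars s = trans (length-varFactors (replicate s 1)) (deg-ones s)
  where
  deg-ones : ∀ s → deg (replicate s 1) ≡ s
  deg-ones zero    = refl
  deg-ones (suc s) = cong suc (deg-ones s)

Unique-allVars : ∀ s → Unique (allVars s)
Unique-allVars zero    = []
Unique-allVars (suc s) =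
  All.tabulate (λ v∈ x₀≡v → let (_ , _ , v≡) = ∈-map⁻ (0 ∷_) v∈ in 1≢0 (Vecₚ.∷-injectiveˡ (trans x₀≡v v≡)))
  ∷ Unique-map⁺ (0 ∷_) (Unique-allVars s) (λ _ _ → Vecₚ.∷-injectiveʳ)
  where
  1≢0 : 1 ≢ 0
  1≢0 ()

∈-allVars : {v : Monomial s} → IsVar v → v ∈ allVars s
∈-allVars {s} {v} vv = var-∣⇒∈varFactors (replicate s 1) vv (∣ones v vv)
  where
  ∣ones : ∀ {s} (v : Monomial s) → IsVar v → v ∣ᵐ replicate s 1
  ∣ones (zero        ∷ v) vv = z≤n ∷ ∣ones v vv
  ∣ones (suc zero    ∷ v) vv = ≤-refl ∷ deg≡0⇒∣ᵐ v (replicate _ 1) (suc-injective vv)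
  ∣ones (suc (suc _) ∷ v) ()

pairUp : List (Monomial s) → List (Monomial s)
pairUp []           = []
pairUp (x ∷ [])     = x · x ∷ []
pairUp (x ∷ y ∷ xs) = x · y ∷ pairUp xs

length-pairUp : (xs : List (Monomial s)) → length (pairUp xs) ≡ ⌈ length xs /2⌉
length-pairUp []           = refl
length-pairUp (x ∷ [])     = refl
length-pairUp (x ∷ y ∷ xs) = cong suc (length-pairUp xs)

pairUp-covers : ∀ (xs : List (Monomial s)) {x} → x ∈ xs → ∃[ m ] m ∈ pairUp xs × x ∣ᵐ m
pairUp-covers (x ∷ [])     (here refl)         = x · x , here refl , u∣u·v x x
pairUp-covers (x ∷ y ∷ xs) (here refl)         = x · y , here refl , u∣u·v x y
pairUp-covers (x ∷ y ∷ xs) (there (here refl)) = x · y , here refl , v∣u·v x y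
pairUp-covers (x ∷ y ∷ xs) (there (there z∈))  =
  let (m , m∈ , z∣m) = pairUp-covers xs z∈ in m , there m∈ , z∣m

pairUp⊆pairProducts : (xs : List (Monomial s)) → pairUp xs ⊆ pairProducts xs
pairUp⊆pairProducts (x ∷ [])     (here refl) = ∈-pairProducts⁺ (x ∷ []) (here refl) (here refl)
pairUp⊆pairProducts (x ∷ y ∷ xs) (here refl) = ∈-pairProducts⁺ (x ∷ y ∷ xs) (here refl) (there (here refl))
pairUp⊆pairProducts (x ∷ y ∷ xs) (there m∈) =
  ∈-++⁺ʳ (map (x ·_) (x ∷ y ∷ xs)) (∈-++⁺ʳ (map (y ·_) (y ∷ xs)) (pairUp⊆pairProducts xs m∈))

Unique-pairProducts : {xs : List (Monomial s)} → Unique xs → All IsVar xs → Unique (pairProducts xs)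
Unique-pairProducts {xs = []}     _            _          = []
Unique-pairProducts {xs = x ∷ xs} !x∷xs@(x∉xs ∷ !xs) vs@(vx ∷ vxs) =
  Unique.++⁺ (Unique-map⁺ (x ·_) !x∷xs (λ _ _ → ·-cancelˡ x _ _)) (Unique-pairProducts !xs vxs) disjoint
  where
  disjoint : ∀ {v} → ¬ (v ∈ map (x ·_) (x ∷ xs) × v ∈ pairProducts xs)
  disjoint (v∈x·xs , v∈pairs) with ∈-map⁻ (x ·_) v∈x·xs | ∈-pairProducts⁻ xs v∈pairs
  ... | y , y∈ , v≡xy | p , q , p∈ , q∈ , v≡pq
    with vars-·-injective vx (All.lookup vs y∈) (All.lookup vxs p∈) (All.lookup vxs q∈) (trans (sym v≡xy) v≡pq)
  ...   | inj₁ (x≡p , _) = All.lookup x∉xs p∈ x≡p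
  ...   | inj₂ (x≡q , _) = All.lookup x∉xs q∈ x≡q

pairProducts-deg : {xs : List (Monomial s)} → All IsVar xs → All (λ v → deg v ≡ 2) (pairProducts xs)
pairProducts-deg {xs = xs} vs = All.tabulate λ v∈ →
  let (x , y , x∈ , y∈ , v≡xy) = ∈-pairProducts⁻ xs v∈ in
  trans (cong deg v≡xy) (deg-var·var x y (All.lookup vs x∈) (All.lookup vs y∈))

-- Order the quadratic monomials so that a pairing of the variables comes first and keep b of them.
∃-covering-quadratics : ∀ {a b} → ⌈ a /2⌉ ≤ b → b ≤ (a + 1) C 2 →
                        ∃[ G ] Unique G × length G ≡ b × All (λ g → deg g ≡ 2) G ×
                               (∀ {x : Monomial a} → IsVar x → ∃[ g ] g ∈ G × x ∣ᵐ g)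
∃-covering-quadratics {a} {b} ⌈a/2⌉≤b b≤choose = G , Unique.take⁺ b !P , length-G , G-deg , covers
  where
  M = pairUp (allVars a)
  X = pairProducts (allVars a)
  P = deduplicate _≟ᵐ_ (M ++ X)
  G = take b P
  !P : Unique P
  !P = UniqueDec.deduplicate-! _≟ᵐ_ (M ++ X)
  P⊆X : P ⊆ X
  P⊆X v∈ with ∈-++⁻ M (∈-deduplicate⁻ _≟ᵐ_ (M ++ X) v∈)
  ... | inj₁ v∈M = pairUp⊆pairProducts (allVars a) v∈M
  ... | inj₂ v∈X = v∈X
  X⊆P : X ⊆ P
  X⊆P v∈ = ∈-deduplicate⁺ _≟ᵐ_ (∈-++⁺ʳ M v∈)
  length-P : length P ≡ (a + 1) C 2
  length-P = begin
    length P                    ≡⟨ Unique-⊆-⊇⇒length≡ !P (Unique-pairProducts (Unique-allVars a) (varFactors-vars (replicate a 1))) P⊆X X⊆P ⟩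
    length X                    ≡⟨ length-pairProducts (allVars a) ⟩
    suc (length (allVars a)) C 2 ≡⟨ cong (_C 2) (trans (cong suc (length-allVars a)) (+-comm 1 a)) ⟩
    (a + 1) C 2                 ∎
    where open ≡-Reasoning
  length-G : length G ≡ b
  length-G = trans (List.length-take b P) (m≤n⇒m⊓n≡m (subst (b ≤_) (sym length-P) b≤choose))
  G-deg : All (λ g → deg g ≡ 2) G
  G-deg = All.tabulate λ g∈ → All.lookup (pairProducts-deg (varFactors-vars (replicate a 1))) (P⊆X (take⊆ b P g∈))
  covers : ∀ {x : Monomial a} → IsVar x → ∃[ g ] g ∈ G × x ∣ᵐ g
  covers vx =
    let (m , m∈M , x∣m) = pairUp-covers (allVars a) (∈-allVars vx)
        |M|≤b = subst (_≤ b) (sym (trans (length-pairUp (allVars a)) (cong ⌈_/2⌉ (length-allVars a)))) ⌈a/2⌉≤b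
    in m , take-mono P |M|≤b (∈-take-deduplicate-++ _≟ᵐ_ M X m∈M) , x∣m

hVector-generated-by-quadratics : ∀ {a} (G : List (Monomial a)) → G ≢ [] → Unique G →
  All (λ g → deg g ≡ 2) G → (∀ {x : Monomial a} → IsVar x → ∃[ g ] g ∈ G × x ∣ᵐ g) →
  hVector (Generated.ideal G) ≡ 1 ∷ a ∷ length G ∷ []
hVector-generated-by-quadratics {a} G G≢[] !G G-deg covers = begin
  hVector ideal                                      ≡⟨ hVector-shape {A = ideal} maxDeg≡2 ⟩
  countDeg ideal 0 ∷ countDeg ideal 1 ∷ countDeg ideal 2 ∷ [] ≡⟨ cong₂ _∷_ (countDeg0≡1 ideal-isOrderIdeal)
                                                                  (cong₂ _∷_ count1 (cong (_∷ []) count2)) ⟩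
  1 ∷ a ∷ length G ∷ []                              ∎
  where
  open ≡-Reasoning
  open Generated G
  ideal-isOrderIdeal = isOrderIdeal G≢[]
  !ideal = IsOrderIdeal.unique ideal-isOrderIdeal
  maxDeg≡2 : maxDeg ideal ≡ 2
  maxDeg≡2 = maximal-degrees⇒maxDeg≡ (IsOrderIdeal.nonempty ideal-isOrderIdeal) (maximal⇒deg≡ G-deg)
  count1 : countDeg ideal 1 ≡ a
  count1 = trans (Unique-⊆-⊇⇒length≡ (Unique-ofDeg 1 !ideal) (Unique-allVars a) ⊆allVars allVars⊆)
                 (length-allVars a)
    where
    ⊆allVars : ofDeg ideal 1 ⊆ allVars a
    ⊆allVars v∈ = ∈-allVars (proj₂ (∈-ofDeg⁻ {A = ideal} 1 v∈))
    allVars⊆ : allVars a ⊆ ofDeg ideal 1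
    allVars⊆ v∈ =
      let vv = All.lookup (varFactors-vars (replicate a 1)) v∈
          (g , g∈G , v∣g) = covers vv
      in ∈-ofDeg⁺ 1 (∈-ideal⁺ g∈G v∣g) vv
  count2 : countDeg ideal 2 ≡ length G
  count2 = Unique-⊆-⊇⇒length≡ (Unique-ofDeg 2 !ideal) !G ⊆G G⊆
    where
    ⊆G : ofDeg ideal 2 ⊆ G
    ⊆G v∈ =
      let (v∈ideal , dv) = ∈-ofDeg⁻ {A = ideal} 2 v∈
          (g , g∈G , v∣g) = ∈-ideal⁻ v∈ideal
      in subst (_∈ G) (sym (∣ᵐ∧deg≡⇒≡ v∣g (trans dv (sym (All.lookup G-deg g∈G))))) g∈G
    G⊆ : G ⊆ ofDeg ideal 2
    G⊆ g∈G = ∈-ofDeg⁺ 2 (∈-ideal⁺ g∈G (∣ᵐ-refl _)) (All.lookup G-deg g∈G)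

bounds⇒IsPureOSequence[1,a,b] : ∀ {a b} → 0 < a → 0 < b → ⌈ a /2⌉ ≤ b → b ≤ (a + 1) C 2 →
                                IsPureOSequence (1 ∷ a ∷ b ∷ [])
bounds⇒IsPureOSequence[1,a,b] {a} 0<a 0<b ⌈a/2⌉≤b b≤choose
  with ∃-covering-quadratics ⌈a/2⌉≤b b≤choose
... | G , !G , refl , G-deg , covers =
  (s≤s z≤n ∷ 0<a ∷ 0<b ∷ []) , a , Generated.ideal G , Generated.isOrderIdeal G G≢[] ,
  Generated.isPure G G-deg , hVector-generated-by-quadratics G G≢[] !G G-deg covers
  where
  G≢[] : G ≢ []
  G≢[] refl = <-irrefl refl 0<b

proposition2p1 : (a b : ℕ) → 0 < a → 0 < b →
    (IsPureOSequence (1 ∷ a ∷ b ∷ []) ⇔ (⌈ a /2⌉ ≤ b × b ≤ (a + 1) C 2))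
    × (IsPureOSequence (1 ∷ a ∷ a ∷ b ∷ []) ⇔ (⌈ a /3⌉ ≤ b × b ≤ a))
proposition2p1 a b 0<a 0<b =
  mk⇔ IsPureOSequence[1,a,b]⇒bounds
      (λ (lower , upper) → bounds⇒IsPureOSequence[1,a,b] 0<a 0<b lower upper) ,
  mk⇔ IsPureOSequence[1,a,a,b]⇒bounds
      (λ (lower , upper) → bounds⇒IsPureOSequence[1,a,a,b] 0<b lower upper)
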